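{- Let $\zeta$ be a trace of $\mathbb Z[S_k]$, $\xi$ a trace of $\mathbb Z[S_{n-k}]$, and let $\theta$ be the trace of $\mathbb Z[B_n]$ given by $\theta=(\zeta\otimes\delta\xi)\big\uparrow_{B_k\times B_{n-k}}^{B_n}$. Then $$\mathrm{Imm}^{B_n}_\theta(\mathbf x)=\sum_{I\subseteq[n],\,|I|=k}\mathrm{Imm}_\zeta(\mathbf x^+_{I,I})\,\mathrm{Imm}_\xi(\mathbf x^-_{[n]\setminus I,[n]\setminus I}).$$
   Context: $[\bar n,n]=\{ -n,\dots,-1,1,\dots,n\}$, $\bar a=-a$, $[n]=\{1,\dots,n\}$. $B_n$ is the group of permutations $w$ of $[\bar n,n]$ with $w(\bar i)=\overline{w(i)}$; $w_i=w(i)$. A trace of $\mathbb Z[G]$ is a $\mathbb Z$-linear functional $\theta$ with $\theta(ab)=\theta(ba)$ (i.e. an integer-valued class function). For $u\in B_m$ let $\ell_t(u)=\#\{i\in[m]:u_i<0\}$ and $\varphi(u)\in S_m$ the permutation $i\mapsto|u_i|$. $\zeta$ is regarded as a trace of $B_k$ via $u\mapsto\zeta(\varphi(u))$, and $\delta\xi$ is the trace of $B_{n-k}$, $u\mapsto(-1)^{\ell_t(u)}\xi(\varphi(u))$. $B_k\times B_{n-k}$ is the subgroup of $w\in B_n$ with $\{|w_1|,\dots,|w_k|\}=[k]$, the second factor acting on $[k+1,n]$ identified with $[1,n-k]$; $\uparrow$ is induction of class functions. Let $\mathbf x=(\mathbf x_{i,j})_{i,j\in[\bar n,n]}$ be commuting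 indeterminates, and define $\mathrm{Imm}^{B_n}_\theta(\mathbf x)=\sum_{w\in B_n}\theta(w)\,\mathbf x_{\bar n,w_{\bar n}}\cdots\mathbf x_{\bar1,w_{\bar1}}\mathbf x_{1,w_1}\cdots\mathbf x_{n,w_n}$. Define $n\times n$ matrices $\mathbf x^\pm$ indexed by $[n]$: $\mathbf x^+_{i,j}=\mathbf x_{i,j}\mathbf x_{\bar i,\bar j}+\mathbf x_{i,\bar j}\mathbf x_{\bar i,j}$, $\mathbf x^-_{i,j}=\mathbf x_{i,j}\mathbf x_{\bar i,\bar j}-\mathbf x_{i,\bar j}\mathbf x_{\bar i,j}$, and $\mathbf x^\pm_{I,J}$ the submatrix with rows $I$ and columns $J$. For a trace $\zeta$ of $S_m$ and a square matrix $Y=(y_{i,j})$ with rows and columns indexed by $I=\{i_1<\cdots<i_m\}$, $\mathrm{Imm}_\zeta(Y)=\sum_{u\in S_m}\zeta(u)\,y_{i_1,i_{u(1)}}\cdots y_{i_m,i_{u(m)}}$ (empty products equal 1 when $m=0$). -}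

module Defs where

open import Level using (Level)
open import Function using (_∘_)
open import Data.Bool using (Bool; true; false; not; _xor_; _∧_; if_then_else_; T)
open import Data.Bool.Properties using () renaming (_≟_ to _≟ᵇ_)
open import Data.Nat as ℕ using (ℕ; zero; suc; NonZero)
open import Data.Nat.Properties using (m*n≢0; m^n≢0)
open import Data.Fin as Fin using (Fin)
open import Data.Fin.Properties using () renaming (_≟_ to _≟ᶠ_)
open import Data.Integer as ℤ using (ℤ; +_; -[1+_])
open import Data.Integer.DivMod using (_/ℕ_)
open import Data.List as List using (List; []; _∷_; _++_; foldr; filterᵇ; concatMap; allFin; cartesianProduct)
open import Data.Bool.ListAction using (any)
open import Data.Vec as Vec using (Vec; []; _∷_; lookup; toList)
open import Data.Vec.Properties using () renaming (≡-dec to vec-≡-dec)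
open import Data.Product using (_×_; _,_; proj₁; proj₂)
open import Data.Product.Properties using () renaming (≡-dec to ×-≡-dec)
open import Data.Sum using (inj₁; inj₂)
open import Data.Maybe using (Maybe; just; nothing; maybe)
open import Relation.Nullary.Decidable using (does)
open import Algebra.Bundles using (CommutativeRing)

allVecs : ∀ {a} {A : Set a} → List A → (n : ℕ) → List (Vec A n)
allVecs xs zero    = [] ∷ []
allVecs xs (suc n) = concatMap (λ x → List.map (x ∷_) (allVecs xs n)) xs

distinctᵇ : ∀ {n} → List (Fin n) → Bool
distinctᵇ []       = true
distinctᵇ (x ∷ xs) = not (any (λ y → does (x ≟ᶠ y)) xs) ∧ distinctᵇ xs

increasingᵇ : ∀ {n} → List (Fin n) → Bool
increasingᵇ []            = true
increasingᵇ (x ∷ [])      = true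
increasingᵇ (x ∷ y ∷ xs)  = does (Fin.toℕ x ℕ.<? Fin.toℕ y) ∧ increasingᵇ (y ∷ xs)

-- The symmetric group S_m : u ∈ S_m is the vector (u(1),…,u(m)) (0-based)

IsPerm : ∀ {m} → Vec (Fin m) m → Set
IsPerm u = T (distinctᵇ (toList u))

Sym : (m : ℕ) → List (Vec (Fin m) m)
Sym m = filterᵇ (distinctᵇ ∘ toList) (allVecs (allFin m) m)

_∘ₛ_ : ∀ {m} → Vec (Fin m) m → Vec (Fin m) m → Vec (Fin m) m
a ∘ₛ b = Vec.map (lookup a) b

IsTrace : (m : ℕ) → (Vec (Fin m) m → ℤ) → Set
IsTrace m ζ = ∀ (a b : Vec (Fin m) m) → IsPerm a → IsPerm b → ζ (a ∘ₛ b) ≡ ζ (b ∘ₛ a)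
  where open import Relation.Binary.PropositionalEquality using (_≡_)

-- Signed indices [n̄,n] : (s , j) stands for ±(j+1), s = true meaning negative

SFin : ℕ → Set
SFin n = Bool × Fin n

negS : ∀ {n} → SFin n → SFin n
negS (s , j) = (not s , j)

allSFin : (n : ℕ) → List (SFin n)
allSFin n = cartesianProduct (true ∷ false ∷ []) (allFin n)

-- The hyperoctahedral group B_n : w is the vector (w_1,…,w_n) of signed
-- values; w_{ī} = - w_i.  w is in B_n iff |w_1|,…,|w_n| are distinct.
Hyp : (n : ℕ) → List (Vec (SFin n) n)
Hyp n = filterᵇ (distinctᵇ ∘ toList ∘ Vec.map proj₂) (allVecs (allSFin n) n)

applyB : ∀ {n} → Vec (SFin n) n → SFin n → SFin n
applyB w (s , j) with lookup w j
... | (s′ , j′) = (s xor s′ , j′)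

_∘ᵦ_ : ∀ {n} → Vec (SFin n) n → Vec (SFin n) n → Vec (SFin n) n
a ∘ᵦ b = Vec.map (applyB a) b

_≟ᵥ_ : ∀ {n} (a b : Vec (SFin n) n) → _
_≟ᵥ_ = vec-≡-dec (×-≡-dec _≟ᵇ_ _≟ᶠ_)

φ : ∀ {m} → Vec (SFin m) m → Vec (Fin m) m
φ = Vec.map proj₂

signℓt : ∀ {l m} → Vec (SFin m) l → ℤ
signℓt []            = + 1
signℓt ((s , _) ∷ u) = (if s then ℤ.- + 1 else + 1) ℤ.* signℓt u

leftPart : ∀ {k m l} → Vec (SFin (k ℕ.+ m)) l → Maybe (Vec (SFin k) l)
leftPart {k} [] = just []
leftPart {k} ((s , j) ∷ u) with Fin.splitAt k j | leftPart {k} u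
... | inj₁ j′ | just v = just ((s , j′) ∷ v)
... | _       | _      = nothing

rightPart : ∀ {k m l} → Vec (SFin (k ℕ.+ m)) l → Maybe (Vec (SFin m) l)
rightPart {k} [] = just []
rightPart {k} ((s , j) ∷ u) with Fin.splitAt k j | rightPart {k} u
... | inj₂ j′ | just v = just ((s , j′) ∷ v)
... | _       | _      = nothing

-- w ∈ B_{k+m} lies in B_k × B_m iff this returns its two components
splitH : ∀ {k m} → Vec (SFin (k ℕ.+ m)) (k ℕ.+ m) → Maybe (Vec (SFin k) k × Vec (SFin m) m)
splitH {k} {m} w with Vec.splitAt k w
... | (w₁ , w₂ , _) with leftPart {k} {m} w₁ | rightPart {k} {m} w₂
...   | just u₁ | just u₂ = just (u₁ , u₂)
...   | _       | _       = nothing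

-- (ζ ⊗ δξ)(u₁,u₂) = ζ(φ u₁) · (-1)^{ℓ_t(u₂)} ξ(φ u₂), extended by 0 outside B_k × B_m
ζ⊗δξ : ∀ k m → (Vec (Fin k) k → ℤ) → (Vec (Fin m) m → ℤ) → Vec (SFin (k ℕ.+ m)) (k ℕ.+ m) → ℤ
ζ⊗δξ k m ζ ξ h = maybe (λ p → ζ (φ (proj₁ p)) ℤ.* (signℓt (proj₂ p) ℤ.* ξ (φ (proj₂ p)))) (+ 0) (splitH {k} {m} h)

_! : ℕ → ℕ
zero  ! = 1
suc n ! = suc n ℕ.* (n !)

fact-nonZero : ∀ n → NonZero (n !)
fact-nonZero zero    = _
fact-nonZero (suc n) = m*n≢0 (suc n) (n !) {{_}} {{fact-nonZero n}}

orderH : ℕ → ℕ → ℕ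
orderH k m = (2 ℕ.^ k ℕ.* (k !)) ℕ.* (2 ℕ.^ m ℕ.* (m !))

orderH-nonZero : ∀ k m → NonZero (orderH k m)
orderH-nonZero k m =
  m*n≢0 _ _ {{m*n≢0 _ _ {{m^n≢0 2 k}} {{fact-nonZero k}}}}
            {{m*n≢0 _ _ {{m^n≢0 2 m}} {{fact-nonZero m}}}}

Σℤ : ∀ {a} {A : Set a} → List A → (A → ℤ) → ℤ
Σℤ xs f = foldr (λ x acc → f x ℤ.+ acc) (+ 0) xs

-- θ = (ζ ⊗ δξ)↑_{B_k×B_m}^{B_{k+m}} :
--   θ(w) = (1/|H|) Σ_{g ∈ B_n} χ°(g⁻¹ w g)
--        = (1/|H|) Σ_{g ∈ B_n} Σ_{h ∈ B_n, w g = g h} χ°(h)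
inducedθ : ∀ k m → (Vec (Fin k) k → ℤ) → (Vec (Fin m) m → ℤ) → Vec (SFin (k ℕ.+ m)) (k ℕ.+ m) → ℤ
inducedθ k m ζ ξ w =
  _/ℕ_ (Σℤ (Hyp (k ℕ.+ m)) (λ g → Σℤ (Hyp (k ℕ.+ m)) (λ h →
          if does ((w ∘ᵦ g) ≟ᵥ (g ∘ᵦ h)) then ζ⊗δξ k m ζ ξ h else + 0)))
       (orderH k m) {{orderH-nonZero k m}}

module RingDefs {c ℓ : Level} (R : CommutativeRing c ℓ) where
  open CommutativeRing R

  natR : ℕ → Carrier
  natR zero    = 0#
  natR (suc n) = 1# + natR n

  ι : ℤ → Carrier
  ι (+ n)      = natR n
  ι -[1+ n ]   = - natR (suc n)

  ΣR : ∀ {a} {A : Set a} → List A → (A → Carrier) → Carrier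
  ΣR xs f = foldr (λ x acc → f x + acc) 0# xs

  ΠR : ∀ {a} {A : Set a} → List A → (A → Carrier) → Carrier
  ΠR xs f = foldr (λ x acc → f x * acc) 1# xs

  ImmB : ∀ {n} → (Vec (SFin n) n → ℤ) → (SFin n → SFin n → Carrier) → Carrier
  ImmB {n} θ x = ΣR (Hyp n) (λ w → ι (θ w) *
    ΠR (allFin n) (λ i → x (true , i) (negS (lookup w i)) * x (false , i) (lookup w i)))

  -- x⁺ and x⁻ (indices in [n] are (false , i))
  xplus : ∀ {n} → (SFin n → SFin n → Carrier) → Fin n → Fin n → Carrier
  xplus x i j = x (false , i) (false , j) * x (true , i) (true , j)
              + x (false , i) (true , j) * x (true , i) (false , j)

  xminus : ∀ {n} → (SFin n → SFin n → Carrier) → Fin n → Fin n → Carrier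
  xminus x i j = x (false , i) (false , j) * x (true , i) (true , j)
               - x (false , i) (true , j) * x (true , i) (false , j)

  -- Imm_ζ(Y_{I,I}) where I = {i_1 < ⋯ < i_m} is given by the vector (i_1,…,i_m)
  Imm : ∀ {n m} → (Vec (Fin m) m → ℤ) → (Fin n → Fin n → Carrier) → Vec (Fin n) m → Carrier
  Imm {n} {m} ζ Y I = ΣR (Sym m) (λ u → ι (ζ u) *
    ΠR (allFin m) (λ a → Y (lookup I a) (lookup I (lookup u a))))

-- k-subsets of [n], as strictly increasing vectors of length k
subsetsInc : (n k : ℕ) → List (Vec (Fin n) k)
subsetsInc n k = filterᵇ (increasingᵇ ∘ toList) (allVecs (allFin n) k)

-- I and J are disjoint (for k-subset I and m-subset J of [k+m], J = [k+m] ∖ I)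
disjointᵇ : ∀ {n k m} → Vec (Fin n) k → Vec (Fin n) m → Bool
disjointᵇ I J = distinctᵇ (toList I ++ toList J)

-- Frobenius' formula for the induced class function θ, with coset representatives rep I J of
-- H = B_k × B_m in B_n: each signed permutation g lies in exactly one coset rep I J · H, namely for I, J the
-- sorted images of the blocks [1,k] and [k+1,n] under |g|. Hence |H| θ(w) = |H| Σ_{I ⊔ J} χ(rep⁻¹ w rep) with
-- χ = ζ ⊗ δξ, and |H| = 2^k k! 2^m m! cancels. For fixed I, J substitute w = rep h rep⁻¹: the monomial of w
-- splits into an I-part and a J-part, χ vanishes off H, and for h = h₁ ⊕ h₂ the sum factors. Summing over the
-- signs of h₁ ∈ B_k turns each x_{ī,w_ī} x_{i,w_i} into an entry of x⁺; in B_m the weight (-1)^{ℓ_t(h₂)}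
-- turns it into an entry of x⁻, leaving Imm_ζ(x⁺_{I,I}) · Imm_ξ(x⁻_{J,J}).

module Submission where

open import Defs
open import Level using (Level)
open import Data.Bool using (if_then_else_)
open import Data.Nat as ℕ using (ℕ)
open import Data.Fin using (Fin)
open import Data.Vec using (Vec)
open import Data.Integer using (ℤ)
open import Algebra.Bundles using (CommutativeRing)

module DistinctVec where

  open import Function using (_∘_)
  open import Function.Bundles using (Equivalence)
  open import Function.Definitions using (Injective)
  open import Data.Bool using (Bool; not; T)
  open import Data.Bool.Properties using (T-∧)
  open import Data.Bool.ListAction using (any)
  open import Data.Empty using (⊥-elim)
  open import Data.Nat using (zero; suc)
  open import Data.Nat.Properties using (1+n≰n)
  open import Data.Fin using (zero; suc; punchOut)
  open import Data.Fin.Properties using (any?; injective⇒≤; punchOut-injective; suc-injective) renaming (_≟_ to _≟ᶠ_)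
  open import Data.Product using (_,_; proj₁; proj₂; ∃)
  open import Data.Vec using ([]; _∷_; lookup; toList)
  open import Relation.Binary.PropositionalEquality using (_≡_; refl; sym; cong)
  open import Relation.Nullary using (¬_; yes; no; does)

  Distinct : ∀ {n l} → Vec (Fin n) l → Set
  Distinct v = Injective _≡_ _≡_ (lookup v)

  private
    occursᵇ : ∀ {n l} → Fin n → Vec (Fin n) l → Bool
    occursᵇ x v = any (λ y → does (x ≟ᶠ y)) (toList v)

    ¬occursᵇ⇒∉ : ∀ {n l} x (v : Vec (Fin n) l) → T (not (occursᵇ x v)) → ∀ i → ¬ lookup v i ≡ x
    ¬occursᵇ⇒∉ x (y ∷ v) t i eq with x ≟ᶠ y
    ¬occursᵇ⇒∉ x (y ∷ v) () i       eq | yes _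
    ¬occursᵇ⇒∉ x (y ∷ v) t  zero    eq | no x≢y = x≢y (sym eq)
    ¬occursᵇ⇒∉ x (y ∷ v) t  (suc i) eq | no _   = ¬occursᵇ⇒∉ x v t i eq

    ∉⇒¬occursᵇ : ∀ {n l} x (v : Vec (Fin n) l) → (∀ i → ¬ lookup v i ≡ x) → T (not (occursᵇ x v))
    ∉⇒¬occursᵇ x []      x∉ = _
    ∉⇒¬occursᵇ x (y ∷ v) x∉ with x ≟ᶠ y
    ... | yes x≡y = x∉ zero (sym x≡y)
    ... | no _    = ∉⇒¬occursᵇ x v (x∉ ∘ suc)

  distinctᵇ⇒Distinct : ∀ {n l} (v : Vec (Fin n) l) → T (distinctᵇ (toList v)) → Distinct v
  distinctᵇ⇒Distinct (x ∷ v) t {zero}  {zero}  eq = refl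
  distinctᵇ⇒Distinct (x ∷ v) t {zero}  {suc j} eq = ⊥-elim (¬occursᵇ⇒∉ x v (proj₁ (Equivalence.to T-∧ t)) j (sym eq))
  distinctᵇ⇒Distinct (x ∷ v) t {suc i} {zero}  eq = ⊥-elim (¬occursᵇ⇒∉ x v (proj₁ (Equivalence.to T-∧ t)) i eq)
  distinctᵇ⇒Distinct (x ∷ v) t {suc i} {suc j} eq = cong suc (distinctᵇ⇒Distinct v (proj₂ (Equivalence.to T-∧ t)) eq)

  Distinct⇒distinctᵇ : ∀ {n l} (v : Vec (Fin n) l) → Distinct v → T (distinctᵇ (toList v))
  Distinct⇒distinctᵇ []      _ = _
  Distinct⇒distinctᵇ (x ∷ v) d = Equivalence.from T-∧
    ( ∉⇒¬occursᵇ x v (λ i eq → suc≢zero (d {suc i} {zero} eq))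
    , Distinct⇒distinctᵇ v (suc-injective ∘ d))
    where
    suc≢zero : ∀ {n} {i : Fin n} → ¬ suc i ≡ zero
    suc≢zero ()

  injective⇒surjective : ∀ {n} (σ : Fin n → Fin n) → Injective _≡_ _≡_ σ → ∀ j → ∃ λ i → σ i ≡ j
  injective⇒surjective {zero}  σ inj ()
  injective⇒surjective {suc n} σ inj j with any? (λ i → σ i ≟ᶠ j)
  ... | yes hit = hit
  ... | no miss = ⊥-elim (1+n≰n (injective⇒≤ τ-injective))
    where
    -- without a preimage of j, σ would inject Fin (suc n) into Fin n by punching out j
    τ : Fin (suc n) → Fin n
    τ i = punchOut {i = j} (λ eq → miss (i , sym eq))
    τ-injective : Injective _≡_ _≡_ τ
    τ-injective {a} {b} eq = inj (punchOut-injective {i = j} (λ e → miss (a , sym e)) (λ e → miss (b , sym e)) eq)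

  preimage : ∀ {n} → (Fin n → Fin n) → Fin n → Fin n
  preimage σ j with any? (λ i → σ i ≟ᶠ j)
  ... | yes (i , _) = i
  ... | no _        = j

  private
    preimage-correct : ∀ {n} (σ : Fin n → Fin n) j → (∃ λ i → σ i ≡ j) → σ (preimage σ j) ≡ j
    preimage-correct σ j hit with any? (λ i → σ i ≟ᶠ j)
    ... | yes (i , σi≡j) = σi≡j
    ... | no miss        = ⊥-elim (miss hit)

  preimage-inverseˡ : ∀ {n} (σ : Fin n → Fin n) → Injective _≡_ _≡_ σ → ∀ i → preimage σ (σ i) ≡ i
  preimage-inverseˡ σ inj i = inj (preimage-correct σ (σ i) (i , refl))

  preimage-inverseʳ : ∀ {n} (σ : Fin n → Fin n) → Injective _≡_ _≡_ σ → ∀ j → σ (preimage σ j) ≡ j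
  preimage-inverseʳ σ inj j = preimage-correct σ j (injective⇒surjective σ inj j)

module ListSum {c ℓ} (M : Algebra.Bundles.CommutativeMonoid c ℓ) where

  open import Function using (_∘_)
  open import Data.Bool using (true; false; T)
  open import Data.Empty using (⊥-elim)
  open import Data.Nat using (zero; suc; _+_)
  open import Data.Fin using (zero; suc; _↑ˡ_; _↑ʳ_)
  open import Data.Product using (_×_; _,_; proj₁; proj₂)
  open import Data.Unit using (⊤; tt)
  open import Data.List using (List; []; _∷_; _++_; foldr; map; concatMap; cartesianProduct; tabulate; allFin)
  open import Data.List.Membership.Propositional using (_∈_; _∉_)
  open import Data.List.Relation.Unary.Any using (here; there)
  open import Data.List.Relation.Unary.All.Properties using (All¬⇒¬Any)
  open import Data.List.Relation.Unary.Unique.Propositional using (Unique)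
  open import Data.List.Relation.Unary.AllPairs using (_∷_)
  open import Relation.Binary.PropositionalEquality as P using (_≡_)
  open import Relation.Binary.Definitions using (DecidableEquality)
  open import Relation.Nullary using (¬_; Dec; yes; no; does)
  open import Function.Definitions using (Injective)
  open import Data.Fin.Properties using () renaming (_≟_ to _≟ᶠ_)
  open import Data.List.Membership.Propositional.Properties using (∈-allFin)
  open import Data.List.Relation.Unary.Unique.Propositional.Properties using (allFin⁺)
  open DistinctVec using (preimage; preimage-inverseˡ; preimage-inverseʳ)
  open Algebra.Bundles.CommutativeMonoid M renaming (Carrier to C)
  open import Algebra.Properties.CommutativeSemigroup commutativeSemigroup using (interchange)
  open import Relation.Binary.Reasoning.Setoid setoid

  private variable
    a b : Level
    A : Set a
    B : Set b

  Σ : List A → (A → C) → C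
  Σ xs f = foldr (λ x acc → f x ∙ acc) ε xs

  Σ-cong-∈ : ∀ (xs : List A) {f g : A → C} → (∀ {x} → x ∈ xs → f x ≈ g x) → Σ xs f ≈ Σ xs g
  Σ-cong-∈ []       f≈g = refl
  Σ-cong-∈ (x ∷ xs) f≈g = ∙-cong (f≈g (here P.refl)) (Σ-cong-∈ xs (f≈g ∘ there))

  Σ-cong : ∀ (xs : List A) {f g : A → C} → (∀ x → f x ≈ g x) → Σ xs f ≈ Σ xs g
  Σ-cong xs f≈g = Σ-cong-∈ xs (λ {x} _ → f≈g x)

  Σ-ε : ∀ (xs : List A) {f : A → C} → (∀ {x} → x ∈ xs → f x ≈ ε) → Σ xs f ≈ ε
  Σ-ε []       f≈ε = refl
  Σ-ε (x ∷ xs) f≈ε = trans (∙-cong (f≈ε (here P.refl)) (Σ-ε xs (f≈ε ∘ there))) (identityˡ ε)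

  Σ-∙ : ∀ (xs : List A) (f g : A → C) → Σ xs (λ x → f x ∙ g x) ≈ Σ xs f ∙ Σ xs g
  Σ-∙ []       f g = sym (identityˡ ε)
  Σ-∙ (x ∷ xs) f g = trans (∙-congˡ (Σ-∙ xs f g)) (interchange (f x) (g x) (Σ xs f) (Σ xs g))

  Σ-swap : ∀ (xs : List A) (ys : List B) (G : A → B → C) →
           Σ xs (λ x → Σ ys (G x)) ≈ Σ ys (λ y → Σ xs (λ x → G x y))
  Σ-swap []       ys G = sym (Σ-ε ys (λ _ → refl))
  Σ-swap (x ∷ xs) ys G =
    trans (∙-congˡ (Σ-swap xs ys G)) (sym (Σ-∙ ys (G x) (λ y → Σ xs (λ x → G x y))))

  Σ-++ : ∀ (xs ys : List A) (f : A → C) → Σ (xs ++ ys) f ≈ Σ xs f ∙ Σ ys f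
  Σ-++ []       ys f = sym (identityˡ _)
  Σ-++ (x ∷ xs) ys f = trans (∙-congˡ (Σ-++ xs ys f)) (sym (assoc _ _ _))

  Σ-map : ∀ (xs : List A) (h : A → B) (f : B → C) → Σ (map h xs) f ≡ Σ xs (f ∘ h)
  Σ-map []       h f = P.refl
  Σ-map (x ∷ xs) h f = P.cong (f (h x) ∙_) (Σ-map xs h f)

  Σ-concatMap : ∀ (xs : List A) (h : A → List B) (f : B → C) →
                Σ (concatMap h xs) f ≈ Σ xs (λ x → Σ (h x) f)
  Σ-concatMap []       h f = refl
  Σ-concatMap (x ∷ xs) h f = trans (Σ-++ (h x) _ f) (∙-congˡ (Σ-concatMap xs h f))

  Σ-cartesianProduct : ∀ (xs : List A) (ys : List B) (f : A × B → C) →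
                       Σ (cartesianProduct xs ys) f ≈ Σ xs (λ x → Σ ys (λ y → f (x , y)))
  Σ-cartesianProduct []       ys f = refl
  Σ-cartesianProduct (x ∷ xs) ys f = trans (Σ-++ (map (x ,_) ys) _ f)
    (∙-cong (reflexive (Σ-map ys (x ,_) f)) (Σ-cartesianProduct xs ys f))

  Σ-tabulate : ∀ {l} (h : Fin l → A) (f : A → C) → Σ (tabulate h) f ≡ Σ (allFin l) (f ∘ h)
  Σ-tabulate {l = zero}  h f = P.refl
  Σ-tabulate {l = suc l} h f =
    P.cong (f (h zero) ∙_) (P.trans (Σ-tabulate (h ∘ suc) f) (P.sym (Σ-tabulate suc (f ∘ h))))

  Σ-allFin-suc : ∀ {l} (f : Fin (suc l) → C) → Σ (allFin (suc l)) f ≡ f zero ∙ Σ (allFin l) (f ∘ suc)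
  Σ-allFin-suc f = P.cong (f zero ∙_) (Σ-tabulate suc f)

  Σ-allFin-+ : ∀ k m (f : Fin (k + m) → C) →
    Σ (allFin (k + m)) f ≈ Σ (allFin k) (λ a → f (a ↑ˡ m)) ∙ Σ (allFin m) (λ b → f (k ↑ʳ b))
  Σ-allFin-+ zero    m f = sym (identityˡ _)
  Σ-allFin-+ (suc k) m f = begin
    Σ (allFin (suc (k + m))) f                                   ≈⟨ reflexive (Σ-allFin-suc f) ⟩
    f zero ∙ Σ (allFin (k + m)) (f ∘ suc)                         ≈⟨ ∙-congˡ (Σ-allFin-+ k m (f ∘ suc)) ⟩
    f zero ∙ (Σ (allFin k) (λ a → f (suc (a ↑ˡ m))) ∙ Σ (allFin m) (λ b → f (suc (k ↑ʳ b))))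
                                                                 ≈⟨ sym (assoc _ _ _) ⟩
    (f zero ∙ Σ (allFin k) (λ a → f (suc (a ↑ˡ m)))) ∙ Σ (allFin m) (λ b → f (suc k ↑ʳ b))
                                                                 ≈⟨ ∙-congʳ (reflexive (P.sym (Σ-allFin-suc (λ a → f (a ↑ˡ m))))) ⟩
    Σ (allFin (suc k)) (λ a → f (a ↑ˡ m)) ∙ Σ (allFin m) (λ b → f (suc k ↑ʳ b)) ∎

  if-congᵗ : ∀ b {x y z : C} → (T b → x ≈ y) → (if b then x else z) ≈ (if b then y else z)
  if-congᵗ true  x≈y = x≈y _
  if-congᵗ false x≈y = refl

  module Indicator {A : Set a} (_≟_ : DecidableEquality A) where

    δ : A → A → C → C
    δ x y c = if does (x ≟ y) then c else ε

    Σ-δ-∉ : ∀ (xs : List A) y (c : A → C) → y ∉ xs → Σ xs (λ x → δ x y (c x)) ≈ ε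
    Σ-δ-∉ xs y c y∉ = Σ-ε xs δ≈ε
      where
      δ≈ε : ∀ {x} → x ∈ xs → δ x y (c x) ≈ ε
      δ≈ε {x} x∈ with x ≟ y
      ... | yes P.refl = ⊥-elim (y∉ x∈)
      ... | no _       = refl

    Σ-δ-∈ : ∀ {xs : List A} {y} (c : A → C) → Unique xs → y ∈ xs → Σ xs (λ x → δ x y (c x)) ≈ c y
    Σ-δ-∈ {x ∷ xs} c (x∉ ∷ _) (here P.refl) with x ≟ x
    ... | yes _  = trans (∙-congˡ (Σ-δ-∉ xs x c (All¬⇒¬Any x∉))) (identityʳ (c x))
    ... | no x≢x = ⊥-elim (x≢x P.refl)
    Σ-δ-∈ {x ∷ xs} {y} c (x∉ ∷ u) (there y∈) with x ≟ y
    ... | yes P.refl = ⊥-elim (All¬⇒¬Any x∉ y∈)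
    ... | no _       = trans (identityˡ _) (Σ-δ-∈ c u y∈)

  Σ-reindex-onto : ∀ {A : Set a} {B : Set b} {s} {S : B → Set s}
    (_≟ᴬ_ : DecidableEquality A) (_≟ᴮ_ : DecidableEquality B) (S? : ∀ y → Dec (S y))
    {xs : List A} {ys : List B} (f : A → B) (g : B → A) (F : B → C) →
    Unique xs → Unique ys →
    (∀ {x} → x ∈ xs → f x ∈ ys × S (f x)) →
    (∀ {y} → y ∈ ys → S y → g y ∈ xs) →
    (∀ {x} → x ∈ xs → g (f x) ≡ x) →
    (∀ {y} → y ∈ ys → S y → f (g y) ≡ y) →
    (∀ {y} → y ∈ ys → ¬ S y → F y ≈ ε) →
    Σ xs (F ∘ f) ≈ Σ ys F
  Σ-reindex-onto {S = S} _≟ᴬ_ _≟ᴮ_ S? {xs} {ys} f g F uxs uys f∈ g∈ gf fg F≈ε = begin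
    Σ xs (F ∘ f)                                   ≈⟨ Σ-cong-∈ xs (λ x∈ → sym (IB.Σ-δ-∈ F uys (proj₁ (f∈ x∈)))) ⟩
    Σ xs (λ x → Σ ys (λ y → IB.δ y (f x) (F y)))   ≈⟨ Σ-swap xs ys _ ⟩
    Σ ys (λ y → Σ xs (λ x → IB.δ y (f x) (F y)))   ≈⟨ Σ-cong-∈ ys fibre ⟩
    Σ ys F                                         ∎
    where
    module IB = Indicator _≟ᴮ_
    module IA = Indicator _≟ᴬ_
    fibre : ∀ {y} → y ∈ ys → Σ xs (λ x → IB.δ y (f x) (F y)) ≈ F y
    fibre {y} y∈ with S? y
    ... | yes Sy = trans (Σ-cong-∈ xs δ≈δ) (IA.Σ-δ-∈ (λ _ → F y) uxs (g∈ y∈ Sy))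
      where
      δ≈δ : ∀ {x} → x ∈ xs → IB.δ y (f x) (F y) ≈ IA.δ x (g y) (F y)
      δ≈δ {x} x∈ with y ≟ᴮ f x | x ≟ᴬ g y
      ... | yes _     | yes _     = refl
      ... | no _      | no _      = refl
      ... | yes y≡fx  | no x≢gy   = ⊥-elim (x≢gy (P.trans (P.sym (gf x∈)) (P.cong g (P.sym y≡fx))))
      ... | no y≢fx   | yes x≡gy  = ⊥-elim (y≢fx (P.trans (P.sym (fg y∈ Sy)) (P.cong f (P.sym x≡gy))))
    ... | no ¬Sy = trans (Σ-ε xs δ≈ε) (sym (F≈ε y∈ ¬Sy))
      where
      δ≈ε : ∀ {x} → x ∈ xs → IB.δ y (f x) (F y) ≈ ε
      δ≈ε {x} x∈ with y ≟ᴮ f x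
      ... | yes P.refl = ⊥-elim (¬Sy (proj₂ (f∈ x∈)))
      ... | no _       = refl

  Σ-reindex : ∀ {A : Set a} {B : Set b}
    (_≟ᴬ_ : DecidableEquality A) (_≟ᴮ_ : DecidableEquality B)
    {xs : List A} {ys : List B} (f : A → B) (g : B → A) (F : B → C) →
    Unique xs → Unique ys →
    (∀ {x} → x ∈ xs → f x ∈ ys) →
    (∀ {y} → y ∈ ys → g y ∈ xs) →
    (∀ {x} → x ∈ xs → g (f x) ≡ x) →
    (∀ {y} → y ∈ ys → f (g y) ≡ y) →
    Σ xs (F ∘ f) ≈ Σ ys F
  Σ-reindex _≟ᴬ_ _≟ᴮ_ f g F uxs uys f∈ g∈ gf fg =
    Σ-reindex-onto {S = λ _ → ⊤} _≟ᴬ_ _≟ᴮ_ (λ _ → yes tt) f g F uxs uys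
      (λ x∈ → f∈ x∈ , tt) (λ y∈ _ → g∈ y∈) gf (λ y∈ _ → fg y∈) (λ _ ¬⊤ → ⊥-elim (¬⊤ tt))

  Σ-permute : ∀ {l} (π : Fin l → Fin l) → Injective _≡_ _≡_ π → ∀ (f : Fin l → C) →
              Σ (allFin l) (f ∘ π) ≈ Σ (allFin l) f
  Σ-permute {l} π π-inj f = Σ-reindex _≟ᶠ_ _≟ᶠ_ π (preimage π) f
    (allFin⁺ l) (allFin⁺ l) (λ _ → ∈-allFin _) (λ _ → ∈-allFin _)
    (λ {i} _ → preimage-inverseˡ π π-inj i) (λ {j} _ → preimage-inverseʳ π π-inj j)

module Enumeration where

  open import Function using (_∘_)
  open import Data.Bool using (Bool; true; false; T)
  open import Data.Nat using (zero; suc)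
  open import Data.Product using (_×_; _,_)
  open import Data.List using (List; []; _∷_; _++_; map; concatMap; filterᵇ; cartesianProductWith)
  open import Data.List.Membership.Propositional using (_∈_)
  open import Data.List.Membership.Propositional.Properties
    using (∈-cartesianProductWith⁺; ∈-cartesianProduct⁺; ∈-filter⁺; ∈-filter⁻; ∈-allFin)
  open import Data.List.Relation.Unary.Any using (here; there)
  open import Data.List.Relation.Unary.Unique.Propositional using (Unique)
  open import Data.List.Relation.Unary.All using ([]; _∷_)
  open import Data.List.Relation.Unary.AllPairs using ([]; _∷_)
  import Data.List.Relation.Unary.Unique.Propositional.Properties as Unique
  open import Data.Vec using ([]; _∷_)
  open import Data.Vec.Properties using (∷-injective)
  open import Relation.Binary.PropositionalEquality using (_≡_; refl; cong)
  open import Relation.Nullary.Decidable using (T?)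

  private variable
    a : Level
    A : Set a

  allVecs-suc : ∀ (xs : List A) n → allVecs xs (suc n) ≡ cartesianProductWith _∷_ xs (allVecs xs n)
  allVecs-suc xs n = go xs
    where
    go : ∀ ys → concatMap (λ y → map (y ∷_) (allVecs xs n)) ys ≡ cartesianProductWith _∷_ ys (allVecs xs n)
    go []       = refl
    go (y ∷ ys) = cong (map (y ∷_) (allVecs xs n) ++_) (go ys)

  ∈-allVecs : ∀ {xs : List A} → (∀ x → x ∈ xs) → ∀ {n} (v : Vec A n) → v ∈ allVecs xs n
  ∈-allVecs         ∈xs []                = here refl
  ∈-allVecs {xs = xs} ∈xs {suc n} (x ∷ v) rewrite allVecs-suc xs n =
    ∈-cartesianProductWith⁺ _∷_ (∈xs x) (∈-allVecs ∈xs v)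

  allVecs-unique : ∀ {xs : List A} → Unique xs → ∀ n → Unique (allVecs xs n)
  allVecs-unique         uxs zero    = [] ∷ []
  allVecs-unique {xs = xs} uxs (suc n) rewrite allVecs-suc xs n =
    Unique.cartesianProductWith⁺ _∷_ ∷-injective uxs (allVecs-unique uxs n)

  ∈-filterᵇ⁺ : ∀ (p : A → Bool) {xs x} → x ∈ xs → T (p x) → x ∈ filterᵇ p xs
  ∈-filterᵇ⁺ p = ∈-filter⁺ (T? ∘ p)

  ∈-filterᵇ⁻ : ∀ (p : A → Bool) {xs x} → x ∈ filterᵇ p xs → x ∈ xs × T (p x)
  ∈-filterᵇ⁻ p {xs} = ∈-filter⁻ (T? ∘ p) {xs = xs}

  filterᵇ-unique : ∀ (p : A → Bool) {xs} → Unique xs → Unique (filterᵇ p xs)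
  filterᵇ-unique p = Unique.filter⁺ (T? ∘ p)

  bools : List Bool
  bools = true ∷ false ∷ []

  ∈-bools : ∀ b → b ∈ bools
  ∈-bools true  = here refl
  ∈-bools false = there (here refl)

  bools-unique : Unique bools
  bools-unique = ((λ ()) ∷ []) ∷ ([] ∷ [])

  ∈-allSFin : ∀ {n} (s : SFin n) → s ∈ allSFin n
  ∈-allSFin (s , j) = ∈-cartesianProduct⁺ (∈-bools s) (∈-allFin j)

  allSFin-unique : ∀ n → Unique (allSFin n)
  allSFin-unique n = Unique.cartesianProduct⁺ bools-unique (Unique.allFin⁺ n)

module IntegerEmbedding {c ℓ} (R : CommutativeRing c ℓ) where

  open import Function using (_∘_)
  open import Data.Nat using (zero; suc; z≤n; s≤s)
  open import Data.Nat.Properties using (+-suc)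
  open import Data.Integer as ℤ using (+_; -[1+_]; _⊖_)
  import Data.Integer.Properties as ℤ
  import Relation.Binary.PropositionalEquality as P
  open CommutativeRing R
  open RingDefs R
  open import Algebra.Properties.Ring ring using (-0#≈0#; -‿+-comm; -‿involutive; -‿distribˡ-*)
  open import Algebra.Properties.CommutativeSemigroup +-commutativeSemigroup using (interchange)
  open import Relation.Binary.Reasoning.Setoid setoid

  natR-+ : ∀ m n → natR (m ℕ.+ n) ≈ natR m + natR n
  natR-+ zero    n = sym (+-identityˡ _)
  natR-+ (suc m) n = trans (+-congˡ (natR-+ m n)) (sym (+-assoc _ _ _))

  x-y≈[o+x]-[o+y] : ∀ o x y → x - y ≈ (o + x) - (o + y)
  x-y≈[o+x]-[o+y] o x y = sym (begin
    (o + x) - (o + y)     ≈⟨ +-congˡ (sym (-‿+-comm o y)) ⟩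
    (o + x) + (- o - y)   ≈⟨ interchange o x (- o) (- y) ⟩
    (o - o) + (x - y)     ≈⟨ +-congʳ (-‿inverseʳ o) ⟩
    0# + (x - y)          ≈⟨ +-identityˡ _ ⟩
    x - y                 ∎)

  ι-⊖ : ∀ m n → ι (m ⊖ n) ≈ natR m - natR n
  ι-⊖ m zero = begin
    ι (m ⊖ 0)       ≈⟨ reflexive (P.cong ι (ℤ.⊖-≥ {m} {0} z≤n)) ⟩
    natR m          ≈⟨ sym (+-identityʳ _) ⟩
    natR m + 0#     ≈⟨ +-congˡ (sym -0#≈0#) ⟩
    natR m - 0#     ∎
  ι-⊖ zero (suc n) = begin
    ι (0 ⊖ suc n)   ≈⟨ reflexive (P.cong ι (ℤ.⊖-< {0} {suc n} (s≤s z≤n))) ⟩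
    - natR (suc n)  ≈⟨ sym (+-identityˡ _) ⟩
    0# - natR (suc n) ∎
  ι-⊖ (suc m) (suc n) = begin
    ι (suc m ⊖ suc n)              ≈⟨ reflexive (P.cong ι (ℤ.[1+m]⊖[1+n]≡m⊖n m n)) ⟩
    ι (m ⊖ n)                      ≈⟨ ι-⊖ m n ⟩
    natR m - natR n                ≈⟨ x-y≈[o+x]-[o+y] 1# (natR m) (natR n) ⟩
    (1# + natR m) - (1# + natR n)  ∎

  ι-+ : ∀ a b → ι (a ℤ.+ b) ≈ ι a + ι b
  ι-+ (+ m)    (+ n)    = natR-+ m n
  ι-+ (+ m)    -[1+ n ] = ι-⊖ m (suc n)
  ι-+ -[1+ m ] (+ n)    = trans (ι-⊖ n (suc m)) (+-comm _ _)
  ι-+ -[1+ m ] -[1+ n ] = begin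
    - natR (suc (suc (m ℕ.+ n)))          ≈⟨ -‿cong (reflexive (P.cong (natR ∘ suc) (+-suc m n))) ⟨
    - natR (suc m ℕ.+ suc n)              ≈⟨ -‿cong (natR-+ (suc m) (suc n)) ⟩
    - (natR (suc m) + natR (suc n))       ≈⟨ -‿+-comm _ _ ⟨
    - natR (suc m) + - natR (suc n)       ∎

  ι-neg : ∀ a → ι (ℤ.- a) ≈ - ι a
  ι-neg (+ zero)  = sym -0#≈0#
  ι-neg (+ suc n) = refl
  ι-neg -[1+ n ]  = sym (-‿involutive _)

  ι-1 : ι (+ 1) ≈ 1#
  ι-1 = +-identityʳ 1#

  ι-*-+ : ∀ n b → ι (+ n ℤ.* b) ≈ natR n * ι b
  ι-*-+ zero b = begin
    ι (+ 0 ℤ.* b)  ≈⟨ reflexive (P.cong ι (ℤ.*-zeroˡ b)) ⟩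
    0#             ≈⟨ zeroˡ _ ⟨
    0# * ι b       ∎
  ι-*-+ (suc n) b = begin
    ι (+ suc n ℤ.* b)            ≈⟨ reflexive (P.cong ι (ℤ.suc-* (+ n) b)) ⟩
    ι (b ℤ.+ + n ℤ.* b)          ≈⟨ ι-+ b (+ n ℤ.* b) ⟩
    ι b + ι (+ n ℤ.* b)          ≈⟨ +-cong (sym (*-identityˡ (ι b))) (ι-*-+ n b) ⟩
    1# * ι b + natR n * ι b      ≈⟨ distribʳ (ι b) 1# (natR n) ⟨
    (1# + natR n) * ι b          ∎

  ι-* : ∀ a b → ι (a ℤ.* b) ≈ ι a * ι b
  ι-* (+ n)    b = ι-*-+ n b
  ι-* -[1+ n ] b = begin
    ι (-[1+ n ] ℤ.* b)       ≈⟨ reflexive (P.cong ι (P.sym (ℤ.neg-distribˡ-* (+ suc n) b))) ⟩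
    ι (ℤ.- (+ suc n ℤ.* b))  ≈⟨ ι-neg (+ suc n ℤ.* b) ⟩
    - ι (+ suc n ℤ.* b)      ≈⟨ -‿cong (ι-*-+ (suc n) b) ⟩
    - (natR (suc n) * ι b)   ≈⟨ -‿distribˡ-* _ _ ⟩
    - natR (suc n) * ι b     ∎

module VecExtensionality where

  open import Data.Vec using (lookup)
  open import Data.Vec.Properties using (tabulate∘lookup; tabulate-cong)
  open import Relation.Binary.PropositionalEquality using (_≡_; trans; sym)

  lookup-ext : ∀ {a} {A : Set a} {l} {u v : Vec A l} → (∀ i → lookup u i ≡ lookup v i) → u ≡ v
  lookup-ext {u = u} {v} u≗v = trans (sym (tabulate∘lookup u)) (trans (tabulate-cong u≗v) (tabulate∘lookup v))

module Signs where

  open import Data.Bool using (Bool; true; false; _xor_; if_then_else_)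
  open import Data.Integer as ℤ using (+_)
  import Data.Integer.Properties as ℤ
  open import Data.Product using (proj₁)
  open import Data.List using (allFin)
  open import Data.Vec using ([]; _∷_; lookup)
  open import Relation.Binary.PropositionalEquality using (_≡_; refl; sym; trans; cong)
  open ListSum ℤ.*-1-commutativeMonoid using () renaming (Σ to Π; Σ-allFin-suc to Π-allFin-suc)

  sign : Bool → ℤ
  sign s = if s then ℤ.- + 1 else + 1

  sign-xor : ∀ a b → sign (a xor b) ≡ sign a ℤ.* sign b
  sign-xor true  true  = refl
  sign-xor true  false = refl
  sign-xor false _     = sym (ℤ.*-identityˡ _)

  signℓt≡Π : ∀ {n l} (v : Vec (SFin n) l) → signℓt v ≡ Π (allFin l) (λ i → sign (proj₁ (lookup v i)))
  signℓt≡Π []      = refl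
  signℓt≡Π (x ∷ v) = trans (cong (sign (proj₁ x) ℤ.*_) (signℓt≡Π v))
                           (sym (Π-allFin-suc (λ i → sign (proj₁ (lookup (x ∷ v) i)))))

module Hyperoctahedral {n : ℕ} where

  open import Function using (_∘_)
  open import Function.Definitions using (Injective)
  open import Data.Bool using (false; _xor_)
  open import Data.Bool.Properties using (xor-assoc; xor-same; xor-identityʳ)
  open import Data.Product using (_,_; proj₁; proj₂)
  open import Data.List.Membership.Propositional using (_∈_)
  open import Data.List.Relation.Unary.Unique.Propositional using (Unique)
  open import Data.List using (allFin)
  open import Data.Vec using (lookup; toList; tabulate)
  open import Data.Vec.Properties using (lookup-map; lookup∘tabulate)
  open import Relation.Binary.PropositionalEquality
  import Data.Integer as ℤ
  import Data.Integer.Properties as ℤ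
  open DistinctVec
  open Enumeration
  open VecExtensionality
  open Signs
  open ListSum ℤ.*-1-commutativeMonoid using ()
    renaming (Σ to Π; Σ-cong to Π-cong; Σ-∙ to Π-*; Σ-permute to Π-permute)

  Signed : Set
  Signed = Vec (SFin n) n

  σ : Signed → Fin n → Fin n
  σ w = proj₂ ∘ lookup w

  record IsHyp (w : Signed) : Set where
    constructor isHyp
    field σ-injective : Injective _≡_ _≡_ (σ w)
  open IsHyp public

  applyB-ext : ∀ {u v : Signed} → (∀ x → applyB u x ≡ applyB v x) → u ≡ v
  applyB-ext u≗v = lookup-ext λ i → u≗v (false , i)

  lookup-∘ᵦ : ∀ (a b : Signed) i → lookup (a ∘ᵦ b) i ≡ applyB a (lookup b i)
  lookup-∘ᵦ a b i = lookup-map i (applyB a) b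

  applyB-∘ᵦ : ∀ (a b : Signed) x → applyB (a ∘ᵦ b) x ≡ applyB a (applyB b x)
  applyB-∘ᵦ a b (s , j) rewrite lookup-∘ᵦ a b j =
    cong (_, proj₂ (lookup a (proj₂ (lookup b j)))) (sym (xor-assoc s _ _))

  σ-∘ᵦ : ∀ (a b : Signed) i → σ (a ∘ᵦ b) i ≡ σ a (σ b i)
  σ-∘ᵦ a b i = cong proj₂ (lookup-∘ᵦ a b i)

  lookup-φ : ∀ (w : Signed) i → lookup (φ w) i ≡ σ w i
  lookup-φ w i = lookup-map i proj₂ w

  ∘ᵦ-assoc : ∀ (a b c : Signed) → (a ∘ᵦ b) ∘ᵦ c ≡ a ∘ᵦ (b ∘ᵦ c)
  ∘ᵦ-assoc a b c = applyB-ext λ x → begin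
    applyB ((a ∘ᵦ b) ∘ᵦ c) x          ≡⟨ applyB-∘ᵦ (a ∘ᵦ b) c x ⟩
    applyB (a ∘ᵦ b) (applyB c x)      ≡⟨ applyB-∘ᵦ a b (applyB c x) ⟩
    applyB a (applyB b (applyB c x))  ≡⟨ cong (applyB a) (applyB-∘ᵦ b c x) ⟨
    applyB a (applyB (b ∘ᵦ c) x)      ≡⟨ applyB-∘ᵦ a (b ∘ᵦ c) x ⟨
    applyB (a ∘ᵦ (b ∘ᵦ c)) x          ∎
    where open ≡-Reasoning

  idᵦ : Signed
  idᵦ = tabulate (false ,_)

  ∘ᵦ-identityʳ : ∀ (w : Signed) → w ∘ᵦ idᵦ ≡ w
  ∘ᵦ-identityʳ w = lookup-ext λ i → trans (lookup-∘ᵦ w idᵦ i) (cong (applyB w) (lookup∘tabulate (false ,_) i))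

  IsHyp⇒∈Hyp : ∀ {w : Signed} → IsHyp w → w ∈ Hyp n
  IsHyp⇒∈Hyp {w} w∈B = ∈-filterᵇ⁺ _ (∈-allVecs ∈-allSFin w)
    (Distinct⇒distinctᵇ (φ w) λ {i} {j} eq →
      σ-injective w∈B (trans (sym (lookup-φ w i)) (trans eq (lookup-φ w j))))

  ∈Hyp⇒IsHyp : ∀ {w : Signed} → w ∈ Hyp n → IsHyp w
  ∈Hyp⇒IsHyp {w} w∈ = isHyp λ {i} {j} eq →
    distinctᵇ⇒Distinct (φ w) (proj₂ (∈-filterᵇ⁻ (distinctᵇ ∘ toList ∘ φ) {xs = allVecs (allSFin n) n} w∈))
      (trans (lookup-φ w i) (trans eq (sym (lookup-φ w j))))

  Hyp-unique : Unique (Hyp n)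
  Hyp-unique = filterᵇ-unique _ (allVecs-unique (allSFin-unique n) n)

  IsHyp-∘ᵦ : ∀ {a b : Signed} → IsHyp a → IsHyp b → IsHyp (a ∘ᵦ b)
  IsHyp-∘ᵦ {a} {b} a∈B b∈B = isHyp λ {i} {j} eq →
    σ-injective b∈B (σ-injective a∈B (trans (sym (σ-∘ᵦ a b i)) (trans eq (σ-∘ᵦ a b j))))

  inv : Signed → Signed
  inv w = tabulate λ j → (proj₁ (lookup w (preimage (σ w) j)) , preimage (σ w) j)

  module _ {g : Signed} (g∈B : IsHyp g) where

    private
      xor-cancel : ∀ a b → (a xor b) xor b ≡ a
      xor-cancel a b = trans (xor-assoc a b b) (trans (cong (a xor_) (xor-same b)) (xor-identityʳ a))

      lookup-inv : ∀ j → lookup (inv g) j ≡ (proj₁ (lookup g (preimage (σ g) j)) , preimage (σ g) j)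
      lookup-inv = lookup∘tabulate _

    inv-applyˡ : ∀ x → applyB (inv g) (applyB g x) ≡ x
    inv-applyˡ (s , j) rewrite lookup-inv (σ g j) | preimage-inverseˡ (σ g) (σ-injective g∈B) j =
      cong (_, j) (xor-cancel s _)

    inv-applyʳ : ∀ x → applyB g (applyB (inv g) x) ≡ x
    inv-applyʳ (s , j) rewrite lookup-inv j | preimage-inverseʳ (σ g) (σ-injective g∈B) j =
      cong (_, j) (xor-cancel s _)

    IsHyp-inv : IsHyp (inv g)
    IsHyp-inv = isHyp λ {i} {j} eq → begin
      i                                             ≡⟨ cong proj₂ (inv-applyʳ (false , i)) ⟨
      σ g (σ (inv g) i)                             ≡⟨ cong (σ g) eq ⟩
      σ g (σ (inv g) j)                             ≡⟨ cong proj₂ (inv-applyʳ (false , j)) ⟩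
      j                                             ∎
      where open ≡-Reasoning

    inv-∘ᵦˡ : ∀ y → inv g ∘ᵦ (g ∘ᵦ y) ≡ y
    inv-∘ᵦˡ y = lookup-ext λ i →
      trans (lookup-∘ᵦ (inv g) (g ∘ᵦ y) i) (trans (cong (applyB (inv g)) (lookup-∘ᵦ g y i)) (inv-applyˡ _))

    inv-∘ᵦʳ : ∀ y → g ∘ᵦ (inv g ∘ᵦ y) ≡ y
    inv-∘ᵦʳ y = lookup-ext λ i →
      trans (lookup-∘ᵦ g (inv g ∘ᵦ y) i) (trans (cong (applyB g) (lookup-∘ᵦ (inv g) y i)) (inv-applyʳ _))

    inv-inverseˡ : inv g ∘ᵦ g ≡ idᵦ
    inv-inverseˡ = lookup-ext λ i →
      trans (lookup-∘ᵦ (inv g) g i) (trans (inv-applyˡ (false , i)) (sym (lookup∘tabulate _ i)))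

    inv-inverseʳ : g ∘ᵦ inv g ≡ idᵦ
    inv-inverseʳ = lookup-ext λ i →
      trans (lookup-∘ᵦ g (inv g) i) (trans (inv-applyʳ (false , i)) (sym (lookup∘tabulate _ i)))

    ∘ᵦ-cancelˡ : ∀ {x y} → g ∘ᵦ x ≡ g ∘ᵦ y → x ≡ y
    ∘ᵦ-cancelˡ {x} {y} eq = trans (sym (inv-∘ᵦˡ x)) (trans (cong (inv g ∘ᵦ_) eq) (inv-∘ᵦˡ y))

  inv-∘ᵦ : ∀ {a b : Signed} → IsHyp a → IsHyp b → inv (a ∘ᵦ b) ≡ inv b ∘ᵦ inv a
  inv-∘ᵦ {a} {b} a∈B b∈B = ∘ᵦ-cancelˡ (IsHyp-∘ᵦ a∈B b∈B) (begin
    (a ∘ᵦ b) ∘ᵦ inv (a ∘ᵦ b)          ≡⟨ inv-inverseʳ (IsHyp-∘ᵦ a∈B b∈B) ⟩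
    idᵦ                               ≡⟨ inv-inverseʳ a∈B ⟨
    a ∘ᵦ inv a                        ≡⟨ cong (a ∘ᵦ_) (inv-∘ᵦʳ b∈B (inv a)) ⟨
    a ∘ᵦ (b ∘ᵦ (inv b ∘ᵦ inv a))      ≡⟨ ∘ᵦ-assoc a b _ ⟨
    (a ∘ᵦ b) ∘ᵦ (inv b ∘ᵦ inv a)      ∎)
    where open ≡-Reasoning

  conj : Signed → Signed → Signed
  conj g y = inv g ∘ᵦ (y ∘ᵦ g)

  unconj : Signed → Signed → Signed
  unconj g h = g ∘ᵦ (h ∘ᵦ inv g)

  IsHyp-conj : ∀ {g y} → IsHyp g → IsHyp y → IsHyp (conj g y)
  IsHyp-conj g∈B y∈B = IsHyp-∘ᵦ (IsHyp-inv g∈B) (IsHyp-∘ᵦ y∈B g∈B)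

  IsHyp-unconj : ∀ {g h} → IsHyp g → IsHyp h → IsHyp (unconj g h)
  IsHyp-unconj g∈B h∈B = IsHyp-∘ᵦ g∈B (IsHyp-∘ᵦ h∈B (IsHyp-inv g∈B))

  conj-unconj : ∀ {g} → IsHyp g → ∀ h → conj g (unconj g h) ≡ h
  conj-unconj {g} g∈B h = begin
    inv g ∘ᵦ ((g ∘ᵦ (h ∘ᵦ inv g)) ∘ᵦ g)   ≡⟨ cong (inv g ∘ᵦ_) (∘ᵦ-assoc g (h ∘ᵦ inv g) g) ⟩
    inv g ∘ᵦ (g ∘ᵦ ((h ∘ᵦ inv g) ∘ᵦ g))   ≡⟨ inv-∘ᵦˡ g∈B _ ⟩
    (h ∘ᵦ inv g) ∘ᵦ g                     ≡⟨ ∘ᵦ-assoc h (inv g) g ⟩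
    h ∘ᵦ (inv g ∘ᵦ g)                     ≡⟨ cong (h ∘ᵦ_) (inv-inverseˡ g∈B) ⟩
    h ∘ᵦ idᵦ                              ≡⟨ ∘ᵦ-identityʳ h ⟩
    h                                     ∎
    where open ≡-Reasoning

  unconj-conj : ∀ {g} → IsHyp g → ∀ y → unconj g (conj g y) ≡ y
  unconj-conj {g} g∈B y = begin
    g ∘ᵦ ((inv g ∘ᵦ (y ∘ᵦ g)) ∘ᵦ inv g)   ≡⟨ cong (g ∘ᵦ_) (∘ᵦ-assoc (inv g) (y ∘ᵦ g) (inv g)) ⟩
    g ∘ᵦ (inv g ∘ᵦ ((y ∘ᵦ g) ∘ᵦ inv g))   ≡⟨ inv-∘ᵦʳ g∈B _ ⟩
    (y ∘ᵦ g) ∘ᵦ inv g                     ≡⟨ ∘ᵦ-assoc y g (inv g) ⟩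
    y ∘ᵦ (g ∘ᵦ inv g)                     ≡⟨ cong (y ∘ᵦ_) (inv-inverseʳ g∈B) ⟩
    y ∘ᵦ idᵦ                              ≡⟨ ∘ᵦ-identityʳ y ⟩
    y                                     ∎
    where open ≡-Reasoning

  conj-∘ᵦ : ∀ {a b} → IsHyp a → IsHyp b → ∀ w → conj (a ∘ᵦ b) w ≡ conj b (conj a w)
  conj-∘ᵦ {a} {b} a∈B b∈B w = begin
    inv (a ∘ᵦ b) ∘ᵦ (w ∘ᵦ (a ∘ᵦ b))         ≡⟨ cong (_∘ᵦ (w ∘ᵦ (a ∘ᵦ b))) (inv-∘ᵦ a∈B b∈B) ⟩
    (inv b ∘ᵦ inv a) ∘ᵦ (w ∘ᵦ (a ∘ᵦ b))     ≡⟨ ∘ᵦ-assoc (inv b) (inv a) _ ⟩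
    inv b ∘ᵦ (inv a ∘ᵦ (w ∘ᵦ (a ∘ᵦ b)))     ≡⟨ cong (λ z → inv b ∘ᵦ (inv a ∘ᵦ z)) (∘ᵦ-assoc w a b) ⟨
    inv b ∘ᵦ (inv a ∘ᵦ ((w ∘ᵦ a) ∘ᵦ b))     ≡⟨ cong (inv b ∘ᵦ_) (∘ᵦ-assoc (inv a) (w ∘ᵦ a) b) ⟨
    inv b ∘ᵦ ((inv a ∘ᵦ (w ∘ᵦ a)) ∘ᵦ b)     ∎
    where open ≡-Reasoning

  conj-invariant : ∀ {a} {A : Set a} (f : Signed → A) →
    (∀ {u v} → IsHyp u → IsHyp v → f (u ∘ᵦ v) ≡ f (v ∘ᵦ u)) →
    ∀ {h y} → IsHyp h → IsHyp y → f (conj h y) ≡ f y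
  conj-invariant f f-comm {h} {y} h∈B y∈B = begin
    f (inv h ∘ᵦ (y ∘ᵦ h))    ≡⟨ f-comm (IsHyp-inv h∈B) (IsHyp-∘ᵦ y∈B h∈B) ⟩
    f ((y ∘ᵦ h) ∘ᵦ inv h)    ≡⟨ cong f (∘ᵦ-assoc y h (inv h)) ⟩
    f (y ∘ᵦ (h ∘ᵦ inv h))    ≡⟨ cong (λ z → f (y ∘ᵦ z)) (inv-inverseʳ h∈B) ⟩
    f (y ∘ᵦ idᵦ)             ≡⟨ cong f (∘ᵦ-identityʳ y) ⟩
    f y                      ∎
    where open ≡-Reasoning

  φ-∘ᵦ : ∀ (a b : Signed) → φ (a ∘ᵦ b) ≡ φ a ∘ₛ φ b
  φ-∘ᵦ a b = lookup-ext λ i → begin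
    lookup (φ (a ∘ᵦ b)) i            ≡⟨ lookup-φ (a ∘ᵦ b) i ⟩
    σ (a ∘ᵦ b) i                     ≡⟨ σ-∘ᵦ a b i ⟩
    σ a (σ b i)                      ≡⟨ lookup-φ a (σ b i) ⟨
    lookup (φ a) (σ b i)             ≡⟨ cong (lookup (φ a)) (lookup-φ b i) ⟨
    lookup (φ a) (lookup (φ b) i)    ≡⟨ lookup-map i (lookup (φ a)) (φ b) ⟨
    lookup (φ a ∘ₛ φ b) i            ∎
    where open ≡-Reasoning

  IsHyp⇒IsPerm : ∀ {w : Signed} → IsHyp w → IsPerm (φ w)
  IsHyp⇒IsPerm {w} w∈B = Distinct⇒distinctᵇ (φ w) λ {i} {j} eq →
    σ-injective w∈B (trans (sym (lookup-φ w i)) (trans eq (lookup-φ w j)))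

  trace-conj : ∀ (ζ : Vec (Fin n) n → ℤ) → IsTrace n ζ → ∀ {h y} → IsHyp h → IsHyp y → ζ (φ (conj h y)) ≡ ζ (φ y)
  trace-conj ζ ζ-trace = conj-invariant (ζ ∘ φ) λ {u} {v} u∈B v∈B → begin
    ζ (φ (u ∘ᵦ v))     ≡⟨ cong ζ (φ-∘ᵦ u v) ⟩
    ζ (φ u ∘ₛ φ v)     ≡⟨ ζ-trace (φ u) (φ v) (IsHyp⇒IsPerm u∈B) (IsHyp⇒IsPerm v∈B) ⟩
    ζ (φ v ∘ₛ φ u)     ≡⟨ cong ζ (φ-∘ᵦ v u) ⟨
    ζ (φ (v ∘ᵦ u))     ∎
    where open ≡-Reasoning

  signℓt-∘ᵦ : ∀ (a : Signed) {b} → IsHyp b → signℓt (a ∘ᵦ b) ≡ signℓt b ℤ.* signℓt a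
  signℓt-∘ᵦ a {b} b∈B = begin
    signℓt (a ∘ᵦ b)
      ≡⟨ signℓt≡Π (a ∘ᵦ b) ⟩
    Π (allFin n) (λ i → sign (proj₁ (lookup (a ∘ᵦ b) i)))
      ≡⟨ Π-cong (allFin n) (λ i → trans (cong (sign ∘ proj₁) (lookup-∘ᵦ a b i)) (sign-xor (proj₁ (lookup b i)) _)) ⟩
    Π (allFin n) (λ i → sign (proj₁ (lookup b i)) ℤ.* sign (proj₁ (lookup a (σ b i))))
      ≡⟨ Π-* (allFin n) (λ i → sign (proj₁ (lookup b i))) (λ i → sign (proj₁ (lookup a (σ b i)))) ⟩
    Π (allFin n) (λ i → sign (proj₁ (lookup b i))) ℤ.* Π (allFin n) (λ i → sign (proj₁ (lookup a (σ b i))))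
      ≡⟨ cong₂ ℤ._*_ (sym (signℓt≡Π b)) (Π-permute (σ b) (σ-injective b∈B) (λ j → sign (proj₁ (lookup a j)))) ⟩
    signℓt b ℤ.* Π (allFin n) (λ j → sign (proj₁ (lookup a j)))
      ≡⟨ cong (signℓt b ℤ.*_) (sym (signℓt≡Π a)) ⟩
    signℓt b ℤ.* signℓt a
      ∎
    where open ≡-Reasoning

  signℓt-conj : ∀ {h y} → IsHyp h → IsHyp y → signℓt (conj h y) ≡ signℓt y
  signℓt-conj = conj-invariant signℓt λ {u} {v} u∈B v∈B →
    trans (signℓt-∘ᵦ u v∈B) (trans (ℤ.*-comm (signℓt v) (signℓt u)) (sym (signℓt-∘ᵦ v u∈B)))

module SplitSubgroup (k m : ℕ) where

  open import Function using (_∘_)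
  open import Data.Bool using (Bool; true; false)
  open import Data.Bool.Properties using () renaming (_≟_ to _≟ᵇ_)
  open import Data.Empty using (⊥-elim)
  open import Data.Nat using (_+_)
  open import Data.Fin as Fin using (zero; suc; _↑ˡ_; _↑ʳ_; splitAt)
  open import Data.Fin.Properties using (all?; ¬∀⟶∃¬; splitAt-↑ˡ; splitAt-↑ʳ; join-splitAt; ↑ˡ-injective; ↑ʳ-injective)
  open import Data.Integer as ℤ using (+_)
  open import Data.Sum using (inj₁; inj₂)
  open import Data.Product using (_×_; _,_; proj₁; proj₂)
  open import Data.Maybe using (just; nothing)
  open import Data.Vec as V using ([]; _∷_; lookup; tabulate; _++_)
  open import Data.Vec.Properties using (lookup-map; lookup∘tabulate; lookup-++ˡ; lookup-++ʳ)
  open import Relation.Binary.PropositionalEquality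
  open import Relation.Nullary using (¬_; Dec; yes; no)
  open VecExtensionality
  open Hyperoctahedral hiding (Signed)

  N : ℕ
  N = k + m

  open Hyperoctahedral {N} public using (Signed)

  isLeft : Fin N → Bool
  isLeft i with splitAt k i
  ... | inj₁ _ = true
  ... | inj₂ _ = false

  isLeft-↑ˡ : ∀ a → isLeft (a ↑ˡ m) ≡ true
  isLeft-↑ˡ a rewrite splitAt-↑ˡ k a m = refl

  isLeft-↑ʳ : ∀ b → isLeft (k ↑ʳ b) ≡ false
  isLeft-↑ʳ b rewrite splitAt-↑ʳ k m b = refl

  true≢false : true ≢ false
  true≢false ()

  data BlockView : Fin N → Set where
    left  : ∀ a → BlockView (a ↑ˡ m)
    right : ∀ b → BlockView (k ↑ʳ b)

  blockView : ∀ i → BlockView i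
  blockView i with splitAt k i in eq
  ... | inj₁ a = subst BlockView (trans (cong (Fin.join k m) (sym eq)) (join-splitAt k m i)) (left a)
  ... | inj₂ b = subst BlockView (trans (cong (Fin.join k m) (sym eq)) (join-splitAt k m i)) (right b)

  lookup-ext-blocks : ∀ {a} {A : Set a} {u v : Vec A N} →
    (∀ i → lookup u (i ↑ˡ m) ≡ lookup v (i ↑ˡ m)) → (∀ j → lookup u (k ↑ʳ j) ≡ lookup v (k ↑ʳ j)) → u ≡ v
  lookup-ext-blocks {u = u} {v} u≗vˡ u≗vʳ = lookup-ext λ i → go (blockView i)
    where
    go : ∀ {i} → BlockView i → lookup u i ≡ lookup v i
    go (left a)  = u≗vˡ a
    go (right b) = u≗vʳ b

  record InH (h : Signed) : Set where
    constructor inH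
    field preserves-blocks : ∀ i → isLeft (σ h i) ≡ isLeft i
  open InH public

  InH? : ∀ h → Dec (InH h)
  InH? h with all? (λ i → isLeft (σ h i) ≟ᵇ isLeft i)
  ... | yes preserved  = yes (inH preserved)
  ... | no ¬preserved  = no (¬preserved ∘ preserves-blocks)

  liftˡ : SFin k → SFin N
  liftˡ (s , j) = (s , j ↑ˡ m)

  liftʳ : SFin m → SFin N
  liftʳ (s , j) = (s , k ↑ʳ j)

  _⊕_ : Vec (SFin k) k → Vec (SFin m) m → Signed
  h₁ ⊕ h₂ = V.map liftˡ h₁ ++ V.map liftʳ h₂

  lookup-⊕-↑ˡ : ∀ h₁ h₂ a → lookup (h₁ ⊕ h₂) (a ↑ˡ m) ≡ liftˡ (lookup h₁ a)
  lookup-⊕-↑ˡ h₁ h₂ a = trans (lookup-++ˡ (V.map liftˡ h₁) (V.map liftʳ h₂) a) (lookup-map a liftˡ h₁)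

  lookup-⊕-↑ʳ : ∀ h₁ h₂ b → lookup (h₁ ⊕ h₂) (k ↑ʳ b) ≡ liftʳ (lookup h₂ b)
  lookup-⊕-↑ʳ h₁ h₂ b = trans (lookup-++ʳ (V.map liftˡ h₁) (V.map liftʳ h₂) b) (lookup-map b liftʳ h₂)

  InH-⊕ : ∀ h₁ h₂ → InH (h₁ ⊕ h₂)
  InH-⊕ h₁ h₂ = inH λ i → go (blockView i)
    where
    go : ∀ {i} → BlockView i → isLeft (σ (h₁ ⊕ h₂) i) ≡ isLeft i
    go (left a)  rewrite lookup-⊕-↑ˡ h₁ h₂ a = trans (isLeft-↑ˡ _) (sym (isLeft-↑ˡ a))
    go (right b) rewrite lookup-⊕-↑ʳ h₁ h₂ b = trans (isLeft-↑ʳ _) (sym (isLeft-↑ʳ b))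

  private
    -- the second argument is a junk default for indices outside the block
    leftIndex : Fin N → Fin k → Fin k
    leftIndex j d with splitAt k j
    ... | inj₁ a = a
    ... | inj₂ _ = d

    rightIndex : Fin N → Fin m → Fin m
    rightIndex j d with splitAt k j
    ... | inj₁ _ = d
    ... | inj₂ b = b

    leftIndex-↑ˡ : ∀ a d → leftIndex (a ↑ˡ m) d ≡ a
    leftIndex-↑ˡ a d rewrite splitAt-↑ˡ k a m = refl

    rightIndex-↑ʳ : ∀ b d → rightIndex (k ↑ʳ b) d ≡ b
    rightIndex-↑ʳ b d rewrite splitAt-↑ʳ k m b = refl

    leftIndex-isLeft : ∀ j d → isLeft j ≡ true → leftIndex j d ↑ˡ m ≡ j
    leftIndex-isLeft j d j-left with splitAt k j in eq
    ... | inj₁ a = trans (cong (Fin.join k m) (sym eq)) (join-splitAt k m j)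
    ... | inj₂ b = ⊥-elim (true≢false (sym j-left))

    rightIndex-isLeft : ∀ j d → isLeft j ≡ false → k ↑ʳ rightIndex j d ≡ j
    rightIndex-isLeft j d j-right with splitAt k j in eq
    ... | inj₂ b = trans (cong (Fin.join k m) (sym eq)) (join-splitAt k m j)
    ... | inj₁ a = ⊥-elim (true≢false j-right)

  restrictˡ : Signed → Vec (SFin k) k
  restrictˡ h = tabulate λ a → (proj₁ (lookup h (a ↑ˡ m)) , leftIndex (σ h (a ↑ˡ m)) a)

  restrictʳ : Signed → Vec (SFin m) m
  restrictʳ h = tabulate λ b → (proj₁ (lookup h (k ↑ʳ b)) , rightIndex (σ h (k ↑ʳ b)) b)

  restrictˡ-⊕ : ∀ h₁ h₂ → restrictˡ (h₁ ⊕ h₂) ≡ h₁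
  restrictˡ-⊕ h₁ h₂ = lookup-ext λ a → trans (lookup∘tabulate _ a)
    (trans (cong (λ p → (proj₁ p , leftIndex (proj₂ p) a)) (lookup-⊕-↑ˡ h₁ h₂ a))
           (cong (proj₁ (lookup h₁ a) ,_) (leftIndex-↑ˡ _ a)))

  restrictʳ-⊕ : ∀ h₁ h₂ → restrictʳ (h₁ ⊕ h₂) ≡ h₂
  restrictʳ-⊕ h₁ h₂ = lookup-ext λ b → trans (lookup∘tabulate _ b)
    (trans (cong (λ p → (proj₁ p , rightIndex (proj₂ p) b)) (lookup-⊕-↑ʳ h₁ h₂ b))
           (cong (proj₁ (lookup h₂ b) ,_) (rightIndex-↑ʳ _ b)))

  ⊕-restrict : ∀ {h} → InH h → restrictˡ h ⊕ restrictʳ h ≡ h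
  ⊕-restrict {h} h∈H = lookup-ext-blocks
    (λ a → trans (lookup-⊕-↑ˡ (restrictˡ h) (restrictʳ h) a) (trans (cong liftˡ (lookup∘tabulate _ a))
       (cong (proj₁ (lookup h (a ↑ˡ m)) ,_)
             (leftIndex-isLeft _ a (trans (preserves-blocks h∈H (a ↑ˡ m)) (isLeft-↑ˡ a))))))
    (λ b → trans (lookup-⊕-↑ʳ (restrictˡ h) (restrictʳ h) b) (trans (cong liftʳ (lookup∘tabulate _ b))
       (cong (proj₁ (lookup h (k ↑ʳ b)) ,_)
             (rightIndex-isLeft _ b (trans (preserves-blocks h∈H (k ↑ʳ b)) (isLeft-↑ʳ b))))))

  private
    leftPart-just : ∀ {l} (v : Vec (SFin N) l) (u : Vec (SFin k) l) →
                    (∀ a → lookup v a ≡ liftˡ (lookup u a)) → leftPart {k} {m} v ≡ just u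
    leftPart-just []            []              v≗u = refl
    leftPart-just ((s , j) ∷ v) ((s′ , j′) ∷ u) v≗u with v≗u zero
    ... | refl rewrite splitAt-↑ˡ k j′ m | leftPart-just v u (v≗u ∘ suc) = refl

    rightPart-just : ∀ {l} (v : Vec (SFin N) l) (u : Vec (SFin m) l) →
                     (∀ a → lookup v a ≡ liftʳ (lookup u a)) → rightPart {k} {m} v ≡ just u
    rightPart-just []            []              v≗u = refl
    rightPart-just ((s , j) ∷ v) ((s′ , j′) ∷ u) v≗u with v≗u zero
    ... | refl rewrite splitAt-↑ʳ k m j′ | rightPart-just v u (v≗u ∘ suc) = refl

    leftPart-nothing : ∀ {l} (v : Vec (SFin N) l) a → isLeft (proj₂ (lookup v a)) ≡ false →
                       leftPart {k} {m} v ≡ nothing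
    leftPart-nothing ((s , j) ∷ v) zero    j-right with splitAt k j
    ... | inj₂ _ = refl
    leftPart-nothing ((s , j) ∷ v) (suc a) v-right with splitAt k j
    ... | inj₂ _ = refl
    ... | inj₁ _ rewrite leftPart-nothing v a v-right = refl

    rightPart-nothing : ∀ {l} (v : Vec (SFin N) l) a → isLeft (proj₂ (lookup v a)) ≡ true →
                        rightPart {k} {m} v ≡ nothing
    rightPart-nothing ((s , j) ∷ v) zero    j-left with splitAt k j
    ... | inj₁ _ = refl
    rightPart-nothing ((s , j) ∷ v) (suc a) v-left with splitAt k j
    ... | inj₁ _ = refl
    ... | inj₂ _ rewrite rightPart-nothing v a v-left = refl

    lookup-↑ˡ-InH : ∀ {h} → InH h → ∀ a → lookup h (a ↑ˡ m) ≡ liftˡ (lookup (restrictˡ h) a)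
    lookup-↑ˡ-InH {h} h∈H a =
      trans (cong (λ z → lookup z (a ↑ˡ m)) (sym (⊕-restrict h∈H))) (lookup-⊕-↑ˡ (restrictˡ h) (restrictʳ h) a)

    lookup-↑ʳ-InH : ∀ {h} → InH h → ∀ b → lookup h (k ↑ʳ b) ≡ liftʳ (lookup (restrictʳ h) b)
    lookup-↑ʳ-InH {h} h∈H b =
      trans (cong (λ z → lookup z (k ↑ʳ b)) (sym (⊕-restrict h∈H))) (lookup-⊕-↑ʳ (restrictˡ h) (restrictʳ h) b)

  splitH-InH : ∀ h → InH h → splitH {k} {m} h ≡ just (restrictˡ h , restrictʳ h)
  splitH-InH h h∈H with V.splitAt k h
  ... | (w₁ , w₂ , h≡w₁++w₂)
    rewrite leftPart-just w₁ (restrictˡ h) (λ a →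
              trans (sym (trans (cong (λ z → lookup z (a ↑ˡ m)) h≡w₁++w₂) (lookup-++ˡ w₁ w₂ a))) (lookup-↑ˡ-InH h∈H a))
          | rightPart-just w₂ (restrictʳ h) (λ b →
              trans (sym (trans (cong (λ z → lookup z (k ↑ʳ b)) h≡w₁++w₂) (lookup-++ʳ w₁ w₂ b))) (lookup-↑ʳ-InH h∈H b))
          = refl

  splitH-¬InH : ∀ h → ¬ InH h → splitH {k} {m} h ≡ nothing
  splitH-¬InH h h∉H with ¬∀⟶∃¬ N (λ i → isLeft (σ h i) ≡ isLeft i) (λ i → isLeft (σ h i) ≟ᵇ isLeft i) (h∉H ∘ inH)
  ... | (i , moved) = go (blockView i) moved
    where
    not-true : ∀ {b} → b ≢ true → b ≡ false
    not-true {true}  b≢true = ⊥-elim (b≢true refl)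
    not-true {false} _      = refl

    not-false : ∀ {b} → b ≢ false → b ≡ true
    not-false {false} b≢false = ⊥-elim (b≢false refl)
    not-false {true}  _       = refl

    go : ∀ {i} → BlockView i → isLeft (σ h i) ≢ isLeft i → splitH {k} {m} h ≡ nothing
    go (left a) moved with V.splitAt k h
    ... | (w₁ , w₂ , h≡w₁++w₂) rewrite leftPart-nothing w₁ a
           (trans (cong (isLeft ∘ proj₂) (sym (trans (cong (λ z → lookup z (a ↑ˡ m)) h≡w₁++w₂) (lookup-++ˡ w₁ w₂ a))))
                  (not-true (λ e → moved (trans e (sym (isLeft-↑ˡ a)))))) = refl
    go (right b) moved with V.splitAt k h
    ... | (w₁ , w₂ , h≡w₁++w₂) with leftPart {k} {m} w₁
    ...   | nothing = refl
    ...   | just _ rewrite rightPart-nothing w₂ b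
           (trans (cong (isLeft ∘ proj₂) (sym (trans (cong (λ z → lookup z (k ↑ʳ b)) h≡w₁++w₂) (lookup-++ʳ w₁ w₂ b))))
                  (not-false (λ e → moved (trans e (sym (isLeft-↑ʳ b)))))) = refl

  private
    applyB-⊕-liftˡ : ∀ a₁ a₂ x → applyB (a₁ ⊕ a₂) (liftˡ x) ≡ liftˡ (applyB a₁ x)
    applyB-⊕-liftˡ a₁ a₂ (s , j) rewrite lookup-⊕-↑ˡ a₁ a₂ j = refl

    applyB-⊕-liftʳ : ∀ a₁ a₂ x → applyB (a₁ ⊕ a₂) (liftʳ x) ≡ liftʳ (applyB a₂ x)
    applyB-⊕-liftʳ a₁ a₂ (s , j) rewrite lookup-⊕-↑ʳ a₁ a₂ j = refl

  ⊕-∘ᵦ : ∀ a₁ a₂ b₁ b₂ → (a₁ ⊕ a₂) ∘ᵦ (b₁ ⊕ b₂) ≡ (a₁ ∘ᵦ b₁) ⊕ (a₂ ∘ᵦ b₂)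
  ⊕-∘ᵦ a₁ a₂ b₁ b₂ = lookup-ext-blocks
    (λ a → begin
      lookup ((a₁ ⊕ a₂) ∘ᵦ (b₁ ⊕ b₂)) (a ↑ˡ m)     ≡⟨ lookup-∘ᵦ (a₁ ⊕ a₂) (b₁ ⊕ b₂) (a ↑ˡ m) ⟩
      applyB (a₁ ⊕ a₂) (lookup (b₁ ⊕ b₂) (a ↑ˡ m)) ≡⟨ cong (applyB (a₁ ⊕ a₂)) (lookup-⊕-↑ˡ b₁ b₂ a) ⟩
      applyB (a₁ ⊕ a₂) (liftˡ (lookup b₁ a))       ≡⟨ applyB-⊕-liftˡ a₁ a₂ (lookup b₁ a) ⟩
      liftˡ (applyB a₁ (lookup b₁ a))              ≡⟨ cong liftˡ (lookup-∘ᵦ a₁ b₁ a) ⟨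
      liftˡ (lookup (a₁ ∘ᵦ b₁) a)                  ≡⟨ lookup-⊕-↑ˡ (a₁ ∘ᵦ b₁) (a₂ ∘ᵦ b₂) a ⟨
      lookup ((a₁ ∘ᵦ b₁) ⊕ (a₂ ∘ᵦ b₂)) (a ↑ˡ m)     ∎)
    (λ b → begin
      lookup ((a₁ ⊕ a₂) ∘ᵦ (b₁ ⊕ b₂)) (k ↑ʳ b)     ≡⟨ lookup-∘ᵦ (a₁ ⊕ a₂) (b₁ ⊕ b₂) (k ↑ʳ b) ⟩
      applyB (a₁ ⊕ a₂) (lookup (b₁ ⊕ b₂) (k ↑ʳ b)) ≡⟨ cong (applyB (a₁ ⊕ a₂)) (lookup-⊕-↑ʳ b₁ b₂ b) ⟩
      applyB (a₁ ⊕ a₂) (liftʳ (lookup b₂ b))       ≡⟨ applyB-⊕-liftʳ a₁ a₂ (lookup b₂ b) ⟩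
      liftʳ (applyB a₂ (lookup b₂ b))              ≡⟨ cong liftʳ (lookup-∘ᵦ a₂ b₂ b) ⟨
      liftʳ (lookup (a₂ ∘ᵦ b₂) b)                  ≡⟨ lookup-⊕-↑ʳ (a₁ ∘ᵦ b₁) (a₂ ∘ᵦ b₂) b ⟨
      lookup ((a₁ ∘ᵦ b₁) ⊕ (a₂ ∘ᵦ b₂)) (k ↑ʳ b)     ∎)
    where open ≡-Reasoning

  ⊕-idᵦ : idᵦ ⊕ idᵦ ≡ idᵦ
  ⊕-idᵦ = lookup-ext-blocks
    (λ a → trans (lookup-⊕-↑ˡ idᵦ idᵦ a) (trans (cong liftˡ (lookup∘tabulate _ a)) (sym (lookup∘tabulate _ (a ↑ˡ m)))))
    (λ b → trans (lookup-⊕-↑ʳ idᵦ idᵦ b) (trans (cong liftʳ (lookup∘tabulate _ b)) (sym (lookup∘tabulate _ (k ↑ʳ b)))))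

  IsHyp-⊕ : ∀ {h₁ h₂} → IsHyp h₁ → IsHyp h₂ → IsHyp (h₁ ⊕ h₂)
  IsHyp-⊕ {h₁} {h₂} h₁∈B h₂∈B = isHyp λ {i} {j} → go (blockView i) (blockView j)
    where
    go : ∀ {i j} → BlockView i → BlockView j → σ (h₁ ⊕ h₂) i ≡ σ (h₁ ⊕ h₂) j → i ≡ j
    go (left a) (left a′) eq rewrite lookup-⊕-↑ˡ h₁ h₂ a | lookup-⊕-↑ˡ h₁ h₂ a′ =
      cong (_↑ˡ m) (σ-injective h₁∈B (↑ˡ-injective m _ _ eq))
    go (right b) (right b′) eq rewrite lookup-⊕-↑ʳ h₁ h₂ b | lookup-⊕-↑ʳ h₁ h₂ b′ =
      cong (k ↑ʳ_) (σ-injective h₂∈B (↑ʳ-injective k _ _ eq))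
    go (left a) (right b) eq rewrite lookup-⊕-↑ˡ h₁ h₂ a | lookup-⊕-↑ʳ h₁ h₂ b =
      ⊥-elim (true≢false (trans (sym (isLeft-↑ˡ _)) (trans (cong isLeft eq) (isLeft-↑ʳ _))))
    go (right b) (left a) eq rewrite lookup-⊕-↑ˡ h₁ h₂ a | lookup-⊕-↑ʳ h₁ h₂ b =
      ⊥-elim (true≢false (trans (sym (isLeft-↑ˡ _)) (trans (cong isLeft (sym eq)) (isLeft-↑ʳ _))))

  IsHyp-restrictˡ : ∀ {h} → IsHyp h → InH h → IsHyp (restrictˡ h)
  IsHyp-restrictˡ {h} h∈B h∈H = isHyp λ {i} {j} eq → ↑ˡ-injective m i j (σ-injective h∈B
    (trans (cong proj₂ (lookup-↑ˡ-InH h∈H i)) (trans (cong (_↑ˡ m) eq) (sym (cong proj₂ (lookup-↑ˡ-InH h∈H j))))))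

  IsHyp-restrictʳ : ∀ {h} → IsHyp h → InH h → IsHyp (restrictʳ h)
  IsHyp-restrictʳ {h} h∈B h∈H = isHyp λ {i} {j} eq → ↑ʳ-injective k i j (σ-injective h∈B
    (trans (cong proj₂ (lookup-↑ʳ-InH h∈H i)) (trans (cong (k ↑ʳ_) eq) (sym (cong proj₂ (lookup-↑ʳ-InH h∈H j))))))

  InH-∘ᵦ : ∀ {a b} → InH a → InH b → InH (a ∘ᵦ b)
  InH-∘ᵦ {a} {b} a∈H b∈H = subst InH
    (trans (sym (⊕-∘ᵦ (restrictˡ a) (restrictʳ a) (restrictˡ b) (restrictʳ b))) (cong₂ _∘ᵦ_ (⊕-restrict a∈H) (⊕-restrict b∈H)))
    (InH-⊕ (restrictˡ a ∘ᵦ restrictˡ b) (restrictʳ a ∘ᵦ restrictʳ b))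

  inv-⊕ : ∀ {h₁ h₂} → IsHyp h₁ → IsHyp h₂ → inv (h₁ ⊕ h₂) ≡ inv h₁ ⊕ inv h₂
  inv-⊕ {h₁} {h₂} h₁∈B h₂∈B = sym (∘ᵦ-cancelˡ (IsHyp-⊕ h₁∈B h₂∈B) (begin
    (h₁ ⊕ h₂) ∘ᵦ (inv h₁ ⊕ inv h₂)     ≡⟨ ⊕-∘ᵦ h₁ h₂ (inv h₁) (inv h₂) ⟩
    (h₁ ∘ᵦ inv h₁) ⊕ (h₂ ∘ᵦ inv h₂)    ≡⟨ cong₂ _⊕_ (inv-inverseʳ h₁∈B) (inv-inverseʳ h₂∈B) ⟩
    idᵦ ⊕ idᵦ                          ≡⟨ ⊕-idᵦ ⟩
    idᵦ                                ≡⟨ inv-inverseʳ (IsHyp-⊕ h₁∈B h₂∈B) ⟨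
    (h₁ ⊕ h₂) ∘ᵦ inv (h₁ ⊕ h₂)         ∎))
    where open ≡-Reasoning

  InH-inv : ∀ {h} → IsHyp h → InH h → InH (inv h)
  InH-inv {h} h∈B h∈H = subst InH
    (trans (sym (inv-⊕ (IsHyp-restrictˡ h∈B h∈H) (IsHyp-restrictʳ h∈B h∈H))) (cong inv (⊕-restrict h∈H)))
    (InH-⊕ (inv (restrictˡ h)) (inv (restrictʳ h)))

  conj-⊕ : ∀ {h₁ h₂} → IsHyp h₁ → IsHyp h₂ → ∀ y₁ y₂ → conj (h₁ ⊕ h₂) (y₁ ⊕ y₂) ≡ conj h₁ y₁ ⊕ conj h₂ y₂
  conj-⊕ {h₁} {h₂} h₁∈B h₂∈B y₁ y₂ = begin
    inv (h₁ ⊕ h₂) ∘ᵦ ((y₁ ⊕ y₂) ∘ᵦ (h₁ ⊕ h₂))       ≡⟨ cong₂ _∘ᵦ_ (inv-⊕ h₁∈B h₂∈B) (⊕-∘ᵦ y₁ y₂ h₁ h₂) ⟩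
    (inv h₁ ⊕ inv h₂) ∘ᵦ ((y₁ ∘ᵦ h₁) ⊕ (y₂ ∘ᵦ h₂))  ≡⟨ ⊕-∘ᵦ (inv h₁) (inv h₂) (y₁ ∘ᵦ h₁) (y₂ ∘ᵦ h₂) ⟩
    conj h₁ y₁ ⊕ conj h₂ y₂                          ∎
    where open ≡-Reasoning

  module Sums {c ℓ} (M : Algebra.Bundles.CommutativeMonoid c ℓ) where
    open Algebra.Bundles.CommutativeMonoid M using (_≈_; ε) renaming (Carrier to C; trans to ≈-trans; sym to ≈-sym)
    open ListSum M using (Σ; Σ-reindex-onto; Σ-cartesianProduct)
    open import Data.List.Membership.Propositional using (_∈_)
    open import Data.List.Membership.Propositional.Properties using (∈-cartesianProduct⁻; ∈-cartesianProduct⁺)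
    open import Data.List.Relation.Unary.Unique.Propositional.Properties using (cartesianProduct⁺)
    open import Data.Product.Properties using () renaming (≡-dec to ×-≡-dec)

    Σ-H : ∀ (F : Signed → C) → (∀ {h} → h ∈ Hyp N → ¬ InH h → F h ≈ ε) →
          Σ (Hyp N) F ≈ Σ (Hyp k) (λ h₁ → Σ (Hyp m) (λ h₂ → F (h₁ ⊕ h₂)))
    Σ-H F F≈ε = ≈-trans
      (≈-sym (Σ-reindex-onto (×-≡-dec _≟ᵥ_ _≟ᵥ_) _≟ᵥ_ InH?
        (λ (h₁ , h₂) → h₁ ⊕ h₂) (λ h → (restrictˡ h , restrictʳ h)) F
        (cartesianProduct⁺ Hyp-unique Hyp-unique) Hyp-unique
        (λ {(h₁ , h₂)} h∈ → let (h₁∈ , h₂∈) = ∈-cartesianProduct⁻ (Hyp k) (Hyp m) h∈ in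
          IsHyp⇒∈Hyp (IsHyp-⊕ (∈Hyp⇒IsHyp h₁∈) (∈Hyp⇒IsHyp h₂∈)) , InH-⊕ h₁ h₂)
        (λ h∈ h∈H → ∈-cartesianProduct⁺ (IsHyp⇒∈Hyp (IsHyp-restrictˡ (∈Hyp⇒IsHyp h∈) h∈H))
                                          (IsHyp⇒∈Hyp (IsHyp-restrictʳ (∈Hyp⇒IsHyp h∈) h∈H)))
        (λ {(h₁ , h₂)} _ → cong₂ _,_ (restrictˡ-⊕ h₁ h₂) (restrictʳ-⊕ h₁ h₂))
        (λ _ h∈H → ⊕-restrict h∈H)
        F≈ε))
      (Σ-cartesianProduct (Hyp k) (Hyp m) (λ (h₁ , h₂) → F (h₁ ⊕ h₂)))

  module Character (ζ : Vec (Fin k) k → ℤ) (ξ : Vec (Fin m) m → ℤ) (ζ-trace : IsTrace k ζ) (ξ-trace : IsTrace m ξ) where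

    χ : Signed → ℤ
    χ = ζ⊗δξ k m ζ ξ

    χ-⊕ : ∀ h₁ h₂ → χ (h₁ ⊕ h₂) ≡ ζ (φ h₁) ℤ.* (signℓt h₂ ℤ.* ξ (φ h₂))
    χ-⊕ h₁ h₂ rewrite splitH-InH (h₁ ⊕ h₂) (InH-⊕ h₁ h₂) | restrictˡ-⊕ h₁ h₂ | restrictʳ-⊕ h₁ h₂ = refl

    χ-¬InH : ∀ h → ¬ InH h → χ h ≡ + 0
    χ-¬InH h h∉H rewrite splitH-¬InH h h∉H = refl

    χ-conj : ∀ {h y} → IsHyp h → InH h → IsHyp y → χ (conj h y) ≡ χ y
    χ-conj {h} {y} h∈B h∈H y∈B with InH? y
    ... | no y∉H = trans (χ-¬InH _ conj∉H) (sym (χ-¬InH y y∉H))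
      where
      conj∉H : ¬ InH (conj h y)
      conj∉H c∈H = y∉H (subst InH (unconj-conj h∈B y) (InH-∘ᵦ h∈H (InH-∘ᵦ c∈H (InH-inv h∈B h∈H))))
    ... | yes y∈H = begin
      χ (conj h y)                                         ≡⟨ cong₂ (λ a b → χ (conj a b)) (⊕-restrict h∈H) (⊕-restrict y∈H) ⟨
      χ (conj (h₁ ⊕ h₂) (y₁ ⊕ y₂))                         ≡⟨ cong χ (conj-⊕ h₁∈B h₂∈B y₁ y₂) ⟩
      χ (conj h₁ y₁ ⊕ conj h₂ y₂)                          ≡⟨ χ-⊕ _ _ ⟩
      ζ (φ (conj h₁ y₁)) ℤ.* (signℓt (conj h₂ y₂) ℤ.* ξ (φ (conj h₂ y₂)))
        ≡⟨ cong₂ ℤ._*_ (trace-conj ζ ζ-trace h₁∈B y₁∈B) (cong₂ ℤ._*_ (signℓt-conj h₂∈B y₂∈B) (trace-conj ξ ξ-trace h₂∈B y₂∈B)) ⟩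
      ζ (φ y₁) ℤ.* (signℓt y₂ ℤ.* ξ (φ y₂))                ≡⟨ χ-⊕ y₁ y₂ ⟨
      χ (y₁ ⊕ y₂)                                          ≡⟨ cong χ (⊕-restrict y∈H) ⟩
      χ y                                                  ∎
      where
      open ≡-Reasoning
      h₁ : Vec (SFin k) k
      h₁ = restrictˡ h
      h₂ : Vec (SFin m) m
      h₂ = restrictʳ h
      y₁ : Vec (SFin k) k
      y₁ = restrictˡ y
      y₂ : Vec (SFin m) m
      y₂ = restrictʳ y
      h₁∈B : IsHyp h₁
      h₁∈B = IsHyp-restrictˡ h∈B h∈H
      h₂∈B : IsHyp h₂
      h₂∈B = IsHyp-restrictʳ h∈B h∈H
      y₁∈B : IsHyp y₁
      y₁∈B = IsHyp-restrictˡ y∈B y∈H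
      y₂∈B : IsHyp y₂
      y₂∈B = IsHyp-restrictʳ y∈B y∈H

module RingSums {c ℓ} (R : CommutativeRing c ℓ) where

  open import Function using (_∘_)
  open import Data.Bool using (Bool; true; false; if_then_else_)
  open import Data.Nat using (zero; suc)
  open import Data.Fin using (zero; suc)
  open import Data.List as List using (List; []; _∷_; allFin)
  open import Data.Vec using (_∷_; lookup)
  open CommutativeRing R hiding (zero)
  open RingDefs R
  open IntegerEmbedding R
  open Enumeration using (bools)
  import Data.Integer as ℤ
  import Relation.Binary.PropositionalEquality as P
  import Data.Integer.Properties as ℤ
  open import Relation.Binary.Reasoning.Setoid setoid
  open ListSum +-commutativeMonoid public using (Σ-cong; Σ-cong-∈; Σ-ε; Σ-swap; Σ-reindex; Σ-concatMap; Σ-map; if-congᵗ)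
  open ListSum *-commutativeMonoid public using ()
    renaming (Σ-cong to Π-cong; Σ-∙ to Π-*; Σ-allFin-suc to Π-allFin-suc; Σ-allFin-+ to Π-allFin-+; Σ-permute to Π-permute)

  private variable
    a b : Level
    A : Set a
    B : Set b

  Σ-*ˡ : ∀ (xs : List A) r (f : A → Carrier) → ΣR xs (λ x → r * f x) ≈ r * ΣR xs f
  Σ-*ˡ []       r f = sym (zeroʳ r)
  Σ-*ˡ (x ∷ xs) r f = trans (+-congˡ (Σ-*ˡ xs r f)) (sym (distribˡ r (f x) (ΣR xs f)))

  Σ-*ʳ : ∀ (xs : List A) r (f : A → Carrier) → ΣR xs (λ x → f x * r) ≈ ΣR xs f * r
  Σ-*ʳ []       r f = sym (zeroˡ r)
  Σ-*ʳ (x ∷ xs) r f = trans (+-congˡ (Σ-*ʳ xs r f)) (sym (distribʳ r (f x) (ΣR xs f)))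

  Σ-*-Σ : ∀ (xs : List A) (ys : List B) (f : A → Carrier) (g : B → Carrier) →
          ΣR xs (λ x → ΣR ys (λ y → f x * g y)) ≈ ΣR xs f * ΣR ys g
  Σ-*-Σ xs ys f g = trans (Σ-cong xs (λ x → Σ-*ˡ ys (f x) g)) (Σ-*ʳ xs (ΣR ys g) f)

  Σ-if : ∀ b (xs : List A) (f : A → Carrier) → ΣR xs (λ x → if b then f x else 0#) ≈ (if b then ΣR xs f else 0#)
  Σ-if true  xs f = refl
  Σ-if false xs f = Σ-ε xs (λ _ → refl)

  ι-Σ : ∀ (xs : List A) (f : A → ℤ) → ι (Σℤ xs f) ≈ ΣR xs (ι ∘ f)
  ι-Σ []       f = refl
  ι-Σ (x ∷ xs) f = trans (ι-+ (f x) (Σℤ xs f)) (+-congˡ (ι-Σ xs f))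

  ι-Π : ∀ (xs : List A) (f : A → ℤ) → ι (ListSum.Σ ℤ.*-1-commutativeMonoid xs f) ≈ ΠR xs (ι ∘ f)
  ι-Π []       f = ι-1
  ι-Π (x ∷ xs) f = trans (ι-* (f x) _) (*-congˡ (ι-Π xs f))

  ι-Σ-*ʳ : ∀ (xs : List A) (f : A → ℤ) r → ι (Σℤ xs f) * r ≈ ΣR xs (λ x → ι (f x) * r)
  ι-Σ-*ʳ xs f r = trans (*-congʳ (ι-Σ xs f)) (sym (Σ-*ʳ xs r (ι ∘ f)))

  ι-if-*ʳ : ∀ b x r → ι (if b then x else ℤ.+ 0) * r ≈ (if b then ι x * r else 0#)
  ι-if-*ʳ true  x r = refl
  ι-if-*ʳ false x r = zeroˡ r

  Σ-allVecs-Π : ∀ l (F : Fin l → Bool → Carrier) →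
    ΣR (allVecs bools l) (λ ε → ΠR (allFin l) (λ a → F a (lookup ε a))) ≈ ΠR (allFin l) (λ a → F a true + F a false)
  Σ-allVecs-Π zero    F = +-identityʳ 1#
  Σ-allVecs-Π (suc l) F = begin
    ΣR (allVecs bools (suc l)) (λ ε → ΠR (allFin (suc l)) (λ a → F a (lookup ε a)))
      ≈⟨ Σ-concatMap bools (λ s → List.map (s ∷_) (allVecs bools l)) (λ ε → ΠR (allFin (suc l)) (λ a → F a (lookup ε a))) ⟩
    ΣR bools (λ s → ΣR (List.map (s ∷_) (allVecs bools l)) (λ ε → ΠR (allFin (suc l)) (λ a → F a (lookup ε a))))
      ≈⟨ Σ-cong bools (λ s → reflexive (Σ-map (allVecs bools l) (s ∷_) (λ ε → ΠR (allFin (suc l)) (λ a → F a (lookup ε a))))) ⟩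
    ΣR bools (λ s → ΣR (allVecs bools l) (λ ε → ΠR (allFin (suc l)) (λ a → F a (lookup (s ∷ ε) a))))
      ≈⟨ Σ-cong bools (λ s → Σ-cong (allVecs bools l) (λ ε → reflexive (Π-allFin-suc (λ a → F a (lookup (s ∷ ε) a))))) ⟩
    ΣR bools (λ s → ΣR (allVecs bools l) (λ ε → F zero s * ΠR (allFin l) (λ a → F (suc a) (lookup ε a))))
      ≈⟨ Σ-cong bools (λ s → Σ-*ˡ (allVecs bools l) (F zero s) (λ ε → ΠR (allFin l) (λ a → F (suc a) (lookup ε a)))) ⟩
    ΣR bools (λ s → F zero s * ΣR (allVecs bools l) (λ ε → ΠR (allFin l) (λ a → F (suc a) (lookup ε a))))
      ≈⟨ Σ-cong bools (λ s → *-congˡ {F zero s} (Σ-allVecs-Π l (F ∘ suc))) ⟩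
    ΣR bools (λ s → F zero s * rest)
      ≈⟨ Σ-*ʳ bools rest (F zero) ⟩
    (F zero true + (F zero false + 0#)) * rest
      ≈⟨ *-congʳ (+-congˡ (+-identityʳ _)) ⟩
    (F zero true + F zero false) * rest
      ≈⟨ reflexive (P.sym (Π-allFin-suc (λ a → F a true + F a false))) ⟩
    ΠR (allFin (suc l)) (λ a → F a true + F a false) ∎
    where
    rest : Carrier
    rest = ΠR (allFin l) (λ a → F (suc a) true + F (suc a) false)

module SignedPermutations where

  open import Function using (_∘_)
  open import Data.Bool using (Bool)
  open import Data.Empty using (⊥-elim)
  open import Data.Nat using (zero; suc; _^_)
  open import Data.Fin using (zero; suc; punchIn; punchOut)
  open import Data.Fin.Properties using (punchInᵢ≢i; punchIn-injective; punchOut-punchIn; punchOut-cong; punchIn-punchOut; suc-injective)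
    renaming (_≟_ to _≟ᶠ_)
  open import Data.Integer as ℤ using (+_)
  import Data.Integer.Properties as ℤ
  open import Data.Product using (_×_; _,_; proj₁; proj₂)
  open import Data.Product.Properties using () renaming (≡-dec to ×-≡-dec)
  open import Data.Bool.Properties using () renaming (_≟_ to _≟ᵇ_)
  open import Data.List as List using (List; []; _∷_; allFin; cartesianProduct)
  open import Data.List.Membership.Propositional using (_∈_)
  open import Data.List.Membership.Propositional.Properties using (∈-cartesianProduct⁻; ∈-cartesianProduct⁺; ∈-allFin)
  open import Data.List.Relation.Unary.Unique.Propositional using (Unique)
  open import Data.List.Relation.Unary.Unique.Propositional.Properties using (cartesianProduct⁺; allFin⁺)
  open import Data.Vec as V using ([]; _∷_; lookup; toList; zipWith)
  open import Data.Vec.Properties using (lookup-map; lookup-zipWith) renaming (≡-dec to Vec-≡-dec)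
  open import Relation.Binary.PropositionalEquality
  open import Relation.Nullary using (yes; no)
  open DistinctVec
  open Enumeration
  open VecExtensionality
  open Hyperoctahedral

  ∈Sym⁺ : ∀ {l} {u : Vec (Fin l) l} → Distinct u → u ∈ Sym l
  ∈Sym⁺ {l} {u} u-distinct = ∈-filterᵇ⁺ _ (∈-allVecs ∈-allFin u) (Distinct⇒distinctᵇ u u-distinct)

  ∈Sym⁻ : ∀ {l} {u : Vec (Fin l) l} → u ∈ Sym l → Distinct u
  ∈Sym⁻ {l} {u} u∈ = distinctᵇ⇒Distinct u (proj₂ (∈-filterᵇ⁻ (distinctᵇ ∘ toList) {xs = allVecs (allFin l) l} u∈))

  Sym-unique : ∀ l → Unique (Sym l)
  Sym-unique l = filterᵇ-unique _ (allVecs-unique (allFin⁺ l) l)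

  withSigns : ∀ {l} → Vec Bool l → Vec (Fin l) l → Vec (SFin l) l
  withSigns = zipWith _,_

  signs : ∀ {l} → Vec (SFin l) l → Vec Bool l
  signs = V.map proj₁

  lookup-withSigns : ∀ {l} (ε : Vec Bool l) (u : Vec (Fin l) l) a → lookup (withSigns ε u) a ≡ (lookup ε a , lookup u a)
  lookup-withSigns ε u a = lookup-zipWith _,_ a ε u

  signs-withSigns : ∀ {l} (ε : Vec Bool l) (u : Vec (Fin l) l) → signs (withSigns ε u) ≡ ε
  signs-withSigns ε u = lookup-ext λ a → trans (lookup-map a proj₁ (withSigns ε u)) (cong proj₁ (lookup-withSigns ε u a))

  φ-withSigns : ∀ {l} (ε : Vec Bool l) (u : Vec (Fin l) l) → φ (withSigns ε u) ≡ u
  φ-withSigns ε u = lookup-ext λ a → trans (lookup-map a proj₂ (withSigns ε u)) (cong proj₂ (lookup-withSigns ε u a))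

  withSigns-signs-φ : ∀ {l} (w : Vec (SFin l) l) → withSigns (signs w) (φ w) ≡ w
  withSigns-signs-φ w = lookup-ext λ a →
    trans (lookup-withSigns (signs w) (φ w) a) (cong₂ _,_ (lookup-map a proj₁ w) (lookup-map a proj₂ w))

  module Sums {c ℓ} (M : Algebra.Bundles.CommutativeMonoid c ℓ) where
    open Algebra.Bundles.CommutativeMonoid M using (_≈_) renaming (Carrier to C; trans to ≈-trans; sym to ≈-sym)
    open ListSum M using (Σ; Σ-reindex; Σ-cartesianProduct)

    Σ-Hyp-withSigns : ∀ {l} (F : Vec (SFin l) l → C) →
      Σ (Hyp l) F ≈ Σ (allVecs bools l) (λ ε → Σ (Sym l) (λ u → F (withSigns ε u)))
    Σ-Hyp-withSigns {l} F = ≈-trans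
      (≈-sym (Σ-reindex (×-≡-dec (Vec-≡-dec _≟ᵇ_) (Vec-≡-dec _≟ᶠ_)) _≟ᵥ_
        (λ (ε , u) → withSigns ε u) (λ w → (signs w , φ w)) F
        (cartesianProduct⁺ (allVecs-unique bools-unique l) (Sym-unique l)) Hyp-unique
        (λ {(ε , u)} εu∈ → IsHyp⇒∈Hyp (isHyp λ {i} {j} eq →
          ∈Sym⁻ (proj₂ (∈-cartesianProduct⁻ (allVecs bools l) (Sym l) εu∈))
            (trans (cong proj₂ (sym (lookup-withSigns ε u i))) (trans eq (cong proj₂ (lookup-withSigns ε u j))))))
        (λ {w} w∈ → ∈-cartesianProduct⁺ (∈-allVecs ∈-bools _)
          (∈Sym⁺ λ {i} {j} eq → σ-injective (∈Hyp⇒IsHyp w∈) (trans (sym (lookup-φ w i)) (trans eq (lookup-φ w j)))))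
        (λ {(ε , u)} _ → cong₂ _,_ (signs-withSigns ε u) (φ-withSigns ε u))
        (λ {w} _ → withSigns-signs-φ w)))
      (Σ-cartesianProduct (allVecs bools l) (Sym l) (λ (ε , u) → F (withSigns ε u)))

  private
    -- punchOut with the junk value zero at the removed point
    punchOut′ : ∀ {n} → Fin (suc (suc n)) → Fin (suc (suc n)) → Fin (suc n)
    punchOut′ j x with j ≟ᶠ x
    ... | yes _   = zero
    ... | no j≢x  = punchOut j≢x

    punchOut′-punchIn : ∀ {n} (j : Fin (suc (suc n))) x → punchOut′ j (punchIn j x) ≡ x
    punchOut′-punchIn j x with j ≟ᶠ punchIn j x
    ... | yes j≡ = ⊥-elim (punchInᵢ≢i j x (sym j≡))
    ... | no _   = trans (punchOut-cong j refl) (punchOut-punchIn j)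

    punchIn-punchOut′ : ∀ {n} (j x : Fin (suc (suc n))) → j ≢ x → punchIn j (punchOut′ j x) ≡ x
    punchIn-punchOut′ j x j≢x with j ≟ᶠ x
    ... | yes j≡x = ⊥-elim (j≢x j≡x)
    ... | no _    = punchIn-punchOut _

    unpunch : ∀ {n} → Fin (suc n) → Vec (Fin (suc n)) n → Vec (Fin n) n
    unpunch {zero}  j [] = []
    unpunch {suc n} j xs = V.map (punchOut′ j) xs

  consPerm : ∀ {n} → Fin (suc n) × Vec (Fin n) n → Vec (Fin (suc n)) (suc n)
  consPerm (j , v) = j ∷ V.map (punchIn j) v

  unconsPerm : ∀ {n} → Vec (Fin (suc n)) (suc n) → Fin (suc n) × Vec (Fin n) n
  unconsPerm (j ∷ xs) = (j , unpunch j xs)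

  unconsPerm-consPerm : ∀ {n} (j : Fin (suc n)) (v : Vec (Fin n) n) → unconsPerm (consPerm (j , v)) ≡ (j , v)
  unconsPerm-consPerm {zero}  j [] = refl
  unconsPerm-consPerm {suc n} j v  = cong (j ,_) (lookup-ext λ i →
    trans (lookup-map i (punchOut′ j) (V.map (punchIn j) v))
          (trans (cong (punchOut′ j) (lookup-map i (punchIn j) v)) (punchOut′-punchIn j (lookup v i))))

  private
    head∉tail : ∀ {n} {j} {xs : Vec (Fin (suc (suc n))) (suc n)} → Distinct (j ∷ xs) → ∀ i → j ≢ lookup xs i
    head∉tail d i eq with d {zero} {suc i} eq
    ... | ()

  consPerm-unconsPerm : ∀ {n} (u : Vec (Fin (suc n)) (suc n)) → Distinct u → consPerm (unconsPerm u) ≡ u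
  consPerm-unconsPerm {zero}  (j ∷ []) _ = refl
  consPerm-unconsPerm {suc n} (j ∷ xs) d = cong (j ∷_) (lookup-ext λ i →
    trans (lookup-map i (punchIn j) (V.map (punchOut′ j) xs))
          (trans (cong (punchIn j) (lookup-map i (punchOut′ j) xs)) (punchIn-punchOut′ j (lookup xs i) (head∉tail d i))))

  Distinct-consPerm : ∀ {n} (j : Fin (suc n)) (v : Vec (Fin n) n) → Distinct v → Distinct (consPerm (j , v))
  Distinct-consPerm j v d {zero}  {zero}  eq = refl
  Distinct-consPerm j v d {zero}  {suc b} eq =
    ⊥-elim (punchInᵢ≢i j (lookup v b) (trans (sym (lookup-map b (punchIn j) v)) (sym eq)))
  Distinct-consPerm j v d {suc a} {zero}  eq =
    ⊥-elim (punchInᵢ≢i j (lookup v a) (trans (sym (lookup-map a (punchIn j) v)) eq))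
  Distinct-consPerm j v d {suc a} {suc b} eq = cong suc (d (punchIn-injective j _ _
    (trans (sym (lookup-map a (punchIn j) v)) (trans eq (lookup-map b (punchIn j) v)))))

  Distinct-unconsPerm : ∀ {n} (u : Vec (Fin (suc n)) (suc n)) → Distinct u → Distinct (proj₂ (unconsPerm u))
  Distinct-unconsPerm {zero}  (j ∷ []) d {()}
  Distinct-unconsPerm {suc n} (j ∷ xs) d {a} {b} eq = suc-injective (d {suc a} {suc b} (begin
    lookup xs a                              ≡⟨ punchIn-punchOut′ j _ (head∉tail d a) ⟨
    punchIn j (punchOut′ j (lookup xs a))     ≡⟨ cong (punchIn j) (lookup-map a (punchOut′ j) xs) ⟨
    punchIn j (lookup (unpunch j xs) a)      ≡⟨ cong (punchIn j) eq ⟩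
    punchIn j (lookup (unpunch j xs) b)      ≡⟨ cong (punchIn j) (lookup-map b (punchOut′ j) xs) ⟩
    punchIn j (punchOut′ j (lookup xs b))     ≡⟨ punchIn-punchOut′ j _ (head∉tail d b) ⟩
    lookup xs b                              ∎))
    where open ≡-Reasoning

  open ListSum ℤ.+-0-commutativeMonoid using (Σ; Σ-cong; Σ-reindex; Σ-cartesianProduct; Σ-concatMap; Σ-map; Σ-allFin-suc)
  open Sums ℤ.+-0-commutativeMonoid using (Σ-Hyp-withSigns)

  Σ-const : ∀ {a} {A : Set a} (xs : List A) c → Σ xs (λ _ → c) ≡ Σ xs (λ _ → + 1) ℤ.* c
  Σ-const []       c = sym (ℤ.*-zeroˡ c)
  Σ-const (x ∷ xs) c = begin
    c ℤ.+ Σ xs (λ _ → c)                     ≡⟨ cong (λ z → c ℤ.+ z) (Σ-const xs c) ⟩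
    c ℤ.+ Σ xs (λ _ → + 1) ℤ.* c             ≡⟨ cong (ℤ._+ Σ xs (λ _ → + 1) ℤ.* c) (ℤ.*-identityˡ c) ⟨
    + 1 ℤ.* c ℤ.+ Σ xs (λ _ → + 1) ℤ.* c     ≡⟨ ℤ.*-distribʳ-+ c (+ 1) (Σ xs (λ _ → + 1)) ⟨
    (+ 1 ℤ.+ Σ xs (λ _ → + 1)) ℤ.* c         ∎
    where open ≡-Reasoning

  Σ-allFin-1 : ∀ l → Σ (allFin l) (λ _ → + 1) ≡ + l
  Σ-allFin-1 zero    = refl
  Σ-allFin-1 (suc l) = trans (Σ-allFin-suc {l = l} (λ _ → + 1)) (cong (λ z → + 1 ℤ.+ z) (Σ-allFin-1 l))

  Σ-allVecs-1 : ∀ l → Σ (allVecs bools l) (λ _ → + 1) ≡ + (2 ^ l)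
  Σ-allVecs-1 zero    = refl
  Σ-allVecs-1 (suc l) = begin
    Σ (allVecs bools (suc l)) (λ _ → + 1)
      ≡⟨ Σ-concatMap bools (λ s → List.map (s ∷_) (allVecs bools l)) (λ _ → + 1) ⟩
    Σ bools (λ s → Σ (List.map (s ∷_) (allVecs bools l)) (λ _ → + 1))
      ≡⟨ Σ-cong bools (λ s → trans (Σ-map (allVecs bools l) (s ∷_) (λ _ → + 1)) (Σ-allVecs-1 l)) ⟩
    + (2 ^ suc l)
      ∎
    where open ≡-Reasoning

  Σ-Sym-1 : ∀ l → Σ (Sym l) (λ _ → + 1) ≡ + (l !)
  Σ-Sym-1 zero    = refl
  Σ-Sym-1 (suc n) = begin
    Σ (Sym (suc n)) (λ _ → + 1)
      ≡⟨ Σ-reindex (×-≡-dec _≟ᶠ_ (Vec-≡-dec _≟ᶠ_)) (Vec-≡-dec _≟ᶠ_) consPerm unconsPerm (λ _ → + 1)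
           (cartesianProduct⁺ (allFin⁺ (suc n)) (Sym-unique n)) (Sym-unique (suc n))
           (λ {(j , v)} jv∈ → ∈Sym⁺ (Distinct-consPerm j v (∈Sym⁻ (proj₂ (∈-cartesianProduct⁻ (allFin (suc n)) (Sym n) jv∈)))))
           (λ {u} u∈ → ∈-cartesianProduct⁺ (∈-allFin _) (∈Sym⁺ (Distinct-unconsPerm u (∈Sym⁻ u∈))))
           (λ {(j , v)} _ → unconsPerm-consPerm j v)
           (λ {u} u∈ → consPerm-unconsPerm u (∈Sym⁻ u∈)) ⟨
    Σ (cartesianProduct (allFin (suc n)) (Sym n)) (λ _ → + 1)
      ≡⟨ Σ-cartesianProduct (allFin (suc n)) (Sym n) (λ _ → + 1) ⟩
    Σ (allFin (suc n)) (λ _ → Σ (Sym n) (λ _ → + 1))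
      ≡⟨ cong (λ c → Σ (allFin (suc n)) (λ _ → c)) (Σ-Sym-1 n) ⟩
    Σ (allFin (suc n)) (λ _ → + (n !))
      ≡⟨ trans (Σ-const (allFin (suc n)) (+ (n !))) (cong (ℤ._* + (n !)) (Σ-allFin-1 (suc n))) ⟩
    + suc n ℤ.* + (n !)
      ≡⟨ ℤ.pos-* (suc n) (n !) ⟨
    + (suc n !)
      ∎
    where open ≡-Reasoning

  Σ-Hyp-1 : ∀ l → Σ (Hyp l) (λ _ → + 1) ≡ + (2 ^ l ℕ.* l !)
  Σ-Hyp-1 l = begin
    Σ (Hyp l) (λ _ → + 1)                                ≡⟨ Σ-Hyp-withSigns {l} (λ _ → + 1) ⟩
    Σ (allVecs bools l) (λ _ → Σ (Sym l) (λ _ → + 1))    ≡⟨ cong (λ c → Σ (allVecs bools l) (λ _ → c)) (Σ-Sym-1 l) ⟩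
    Σ (allVecs bools l) (λ _ → + (l !))                  ≡⟨ Σ-const (allVecs bools l) (+ (l !)) ⟩
    Σ (allVecs bools l) (λ _ → + 1) ℤ.* + (l !)          ≡⟨ cong (ℤ._* + (l !)) (Σ-allVecs-1 l) ⟩
    + (2 ^ l) ℤ.* + (l !)                                ≡⟨ ℤ.pos-* (2 ^ l) (l !) ⟨
    + (2 ^ l ℕ.* l !)                                    ∎
    where open ≡-Reasoning

module IncreasingVec {n : ℕ} where

  open import Function using (_∘_)
  open import Function.Bundles using (Equivalence)
  open import Data.Bool using (T)
  open import Data.Bool.Properties using (T-∧)
  open import Data.Unit using (⊤; tt)
  open import Data.Empty using (⊥-elim)
  open import Data.Nat using (zero; suc; _<_; _<?_)
  open import Data.Nat.Properties using (<ᵇ⇒<; <⇒<ᵇ; <-trans; <-irrefl; <-asym; <-cmp)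
  open import Data.Fin using (zero; suc; toℕ)
  open import Data.Fin.Properties using (toℕ-injective; suc-injective)
  open import Data.Sum using (_⊎_; inj₁; inj₂)
  open import Data.Product using (_×_; _,_; ∃)
  open import Data.Vec using ([]; _∷_; lookup; toList)
  open import Relation.Binary.PropositionalEquality
  open import Relation.Binary.Definitions using (tri<; tri≈; tri>)
  open import Relation.Nullary using (¬_; yes; no)
  open DistinctVec using (Distinct)

  _∈ᵥ_ : ∀ {l} → Fin n → Vec (Fin n) l → Set
  x ∈ᵥ v = ∃ λ a → lookup v a ≡ x

  ∈ᵥ-there : ∀ {l} {z} x (v : Vec (Fin n) l) → z ∈ᵥ v → z ∈ᵥ (x ∷ v)
  ∈ᵥ-there x v (a , va≡z) = suc a , va≡z

  ∈ᵥ-∷⁻ : ∀ {l} {z} x (v : Vec (Fin n) l) → z ∈ᵥ (x ∷ v) → z ≡ x ⊎ z ∈ᵥ v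
  ∈ᵥ-∷⁻ x v (zero  , x≡z)  = inj₁ (sym x≡z)
  ∈ᵥ-∷⁻ x v (suc a , va≡z) = inj₂ (a , va≡z)

  _<ᶠ_ : Fin n → Fin n → Set
  x <ᶠ y = toℕ x < toℕ y

  Increasing : ∀ {l} → Vec (Fin n) l → Set
  Increasing []      = ⊤
  Increasing (x ∷ v) = (∀ a → x <ᶠ lookup v a) × Increasing v

  private
    below-∈ᵥ : ∀ {l} {x : Fin n} (v : Vec (Fin n) l) → (∀ a → x <ᶠ lookup v a) → ∀ {z} → z ∈ᵥ v → x <ᶠ z
    below-∈ᵥ v x<v (a , refl) = x<v a

    Increasing-∷∷ : ∀ {l} x y (w : Vec (Fin n) l) → x <ᶠ y → Increasing (y ∷ w) → Increasing (x ∷ y ∷ w)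
    Increasing-∷∷ x y w x<y (y<w , w↑) = x<y∷w , (y<w , w↑)
      where
      x<y∷w : ∀ a → x <ᶠ lookup (y ∷ w) a
      x<y∷w zero    = x<y
      x<y∷w (suc a) = <-trans x<y (y<w a)

  increasingᵇ⇒Increasing : ∀ {l} (v : Vec (Fin n) l) → T (increasingᵇ (toList v)) → Increasing v
  increasingᵇ⇒Increasing []          _ = tt
  increasingᵇ⇒Increasing (x ∷ [])    _ = (λ ()) , tt
  increasingᵇ⇒Increasing (x ∷ y ∷ w) t = let (x<y , y∷w↑) = Equivalence.to T-∧ t in
    Increasing-∷∷ x y w (<ᵇ⇒< (toℕ x) (toℕ y) x<y) (increasingᵇ⇒Increasing (y ∷ w) y∷w↑)

  Increasing⇒increasingᵇ : ∀ {l} (v : Vec (Fin n) l) → Increasing v → T (increasingᵇ (toList v))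
  Increasing⇒increasingᵇ []          _           = tt
  Increasing⇒increasingᵇ (x ∷ [])    _           = tt
  Increasing⇒increasingᵇ (x ∷ y ∷ w) (x<y∷w , y∷w↑) =
    Equivalence.from T-∧ (<⇒<ᵇ (x<y∷w zero) , Increasing⇒increasingᵇ (y ∷ w) y∷w↑)

  Increasing⇒Distinct : ∀ {l} (v : Vec (Fin n) l) → Increasing v → Distinct v
  Increasing⇒Distinct (x ∷ v) (x<v , v↑) {zero}  {zero}  eq = refl
  Increasing⇒Distinct (x ∷ v) (x<v , v↑) {zero}  {suc b} eq = ⊥-elim (<-irrefl (cong toℕ eq) (x<v b))
  Increasing⇒Distinct (x ∷ v) (x<v , v↑) {suc a} {zero}  eq = ⊥-elim (<-irrefl (cong toℕ (sym eq)) (x<v a))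
  Increasing⇒Distinct (x ∷ v) (x<v , v↑) {suc a} {suc b} eq = cong suc (Increasing⇒Distinct v v↑ eq)

  insert : ∀ {l} → Fin n → Vec (Fin n) l → Vec (Fin n) (suc l)
  insert x []      = x ∷ []
  insert x (y ∷ v) with toℕ x <? toℕ y
  ... | yes _ = x ∷ y ∷ v
  ... | no _  = y ∷ insert x v

  ∈-insert⁻ : ∀ {l} x (v : Vec (Fin n) l) {z} → z ∈ᵥ insert x v → z ≡ x ⊎ z ∈ᵥ v
  ∈-insert⁻ x []      (zero , x≡z) = inj₁ (sym x≡z)
  ∈-insert⁻ x (y ∷ v) z∈ with toℕ x <? toℕ y
  ... | yes _ = ∈ᵥ-∷⁻ x (y ∷ v) z∈
  ... | no _ with ∈ᵥ-∷⁻ y (insert x v) z∈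
  ...   | inj₁ z≡y  = inj₂ (zero , sym z≡y)
  ...   | inj₂ z∈′ with ∈-insert⁻ x v z∈′
  ...     | inj₁ z≡x  = inj₁ z≡x
  ...     | inj₂ z∈v  = inj₂ (∈ᵥ-there y v z∈v)

  ∈-insert⁺ : ∀ {l} x (v : Vec (Fin n) l) {z} → z ≡ x ⊎ z ∈ᵥ v → z ∈ᵥ insert x v
  ∈-insert⁺ x []      (inj₁ refl) = zero , refl
  ∈-insert⁺ x (y ∷ v) z∈ with toℕ x <? toℕ y
  ∈-insert⁺ x (y ∷ v) (inj₁ refl)          | yes _ = zero , refl
  ∈-insert⁺ x (y ∷ v) (inj₂ (a , va≡z))    | yes _ = suc a , va≡z
  ∈-insert⁺ x (y ∷ v) (inj₁ refl)          | no _  = ∈ᵥ-there y (insert x v) (∈-insert⁺ x v (inj₁ refl))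
  ∈-insert⁺ x (y ∷ v) (inj₂ (zero , y≡z))  | no _  = zero , y≡z
  ∈-insert⁺ x (y ∷ v) (inj₂ (suc a , va≡z)) | no _ = ∈ᵥ-there y (insert x v) (∈-insert⁺ x v (inj₂ (a , va≡z)))

  insert-increasing : ∀ {l} x (v : Vec (Fin n) l) → Increasing v → (∀ a → lookup v a ≢ x) → Increasing (insert x v)
  insert-increasing x []      _            _   = (λ ()) , tt
  insert-increasing x (y ∷ v) (y<v , v↑) x∉v with toℕ x <? toℕ y
  ... | yes x<y = Increasing-∷∷ x y v x<y (y<v , v↑)
  ... | no x≮y  = (λ a → y<insert (a , refl)) , insert-increasing x v v↑ (x∉v ∘ suc)
    where
    y<x : y <ᶠ x
    y<x with <-cmp (toℕ y) (toℕ x)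
    ... | tri< y<x _ _ = y<x
    ... | tri≈ _ y≡x _ = ⊥-elim (x∉v zero (toℕ-injective y≡x))
    ... | tri> _ _ x<y = ⊥-elim (x≮y x<y)
    y<insert : ∀ {z} → z ∈ᵥ insert x v → y <ᶠ z
    y<insert z∈ with ∈-insert⁻ x v z∈
    ... | inj₁ refl = y<x
    ... | inj₂ z∈v  = below-∈ᵥ v y<v z∈v

  sort : ∀ {l} → Vec (Fin n) l → Vec (Fin n) l
  sort []      = []
  sort (x ∷ v) = insert x (sort v)

  ∈-sort⁻ : ∀ {l} (v : Vec (Fin n) l) {z} → z ∈ᵥ sort v → z ∈ᵥ v
  ∈-sort⁻ (x ∷ v) z∈ with ∈-insert⁻ x (sort v) z∈
  ... | inj₁ refl = zero , refl
  ... | inj₂ z∈′  = ∈ᵥ-there x v (∈-sort⁻ v z∈′)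

  ∈-sort⁺ : ∀ {l} (v : Vec (Fin n) l) {z} → z ∈ᵥ v → z ∈ᵥ sort v
  ∈-sort⁺ (x ∷ v) (zero  , refl)   = ∈-insert⁺ x (sort v) (inj₁ refl)
  ∈-sort⁺ (x ∷ v) (suc a , va≡z)   = ∈-insert⁺ x (sort v) (inj₂ (∈-sort⁺ v (a , va≡z)))

  sort-increasing : ∀ {l} (v : Vec (Fin n) l) → Distinct v → Increasing (sort v)
  sort-increasing []      _ = tt
  sort-increasing (x ∷ v) d = insert-increasing x (sort v) (sort-increasing v (suc-injective ∘ d))
    (λ a eq → let (b , vb≡) = ∈-sort⁻ v (a , eq) in zero≢suc (d {zero} {suc b} (sym vb≡)))
    where
    zero≢suc : ∀ {l} {i : Fin l} → ¬ zero ≡ suc i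
    zero≢suc ()

  Increasing-unique : ∀ {l} (u v : Vec (Fin n) l) → Increasing u → Increasing v →
    (∀ z → z ∈ᵥ u → z ∈ᵥ v) → (∀ z → z ∈ᵥ v → z ∈ᵥ u) → u ≡ v
  Increasing-unique []      []      _          _          _   _   = refl
  Increasing-unique (x ∷ u) (y ∷ v) (x<u , u↑) (y<v , v↑) u⊆v v⊆u = cong₂ _∷_ x≡y (Increasing-unique u v u↑ v↑ u⊆v′ v⊆u′)
    where
    -- both heads are the minimum of the common set of entries
    x≡y : x ≡ y
    x≡y with ∈ᵥ-∷⁻ y v (u⊆v x (zero , refl)) | ∈ᵥ-∷⁻ x u (v⊆u y (zero , refl))
    ... | inj₁ x≡y | _        = x≡y
    ... | inj₂ _   | inj₁ y≡x = sym y≡x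
    ... | inj₂ x∈v | inj₂ y∈u = ⊥-elim (<-asym (below-∈ᵥ v y<v x∈v) (below-∈ᵥ u x<u y∈u))
    u⊆v′ : ∀ z → z ∈ᵥ u → z ∈ᵥ v
    u⊆v′ z z∈u with ∈ᵥ-∷⁻ y v (u⊆v z (∈ᵥ-there x u z∈u))
    ... | inj₂ z∈v  = z∈v
    ... | inj₁ refl = ⊥-elim (<-irrefl (cong toℕ x≡y) (below-∈ᵥ u x<u z∈u))
    v⊆u′ : ∀ z → z ∈ᵥ v → z ∈ᵥ u
    v⊆u′ z z∈v with ∈ᵥ-∷⁻ x u (v⊆u z (∈ᵥ-there y v z∈v))
    ... | inj₂ z∈u  = z∈u
    ... | inj₁ refl = ⊥-elim (<-irrefl (cong toℕ (sym x≡y)) (below-∈ᵥ v y<v z∈v))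

module Cosets (k m : ℕ) where

  open import Function using (_∘_)
  open import Data.Bool using (true; false; T)
  open import Data.Empty using (⊥-elim)
  open import Data.Fin using (_↑ˡ_; _↑ʳ_)
  open import Data.Fin.Properties using (↑ˡ-injective; ↑ʳ-injective)
  open import Data.Product using (_×_; _,_; proj₂; ∃)
  open import Data.List using (allFin)
  open import Data.List.Membership.Propositional using (_∈_)
  open import Data.List.Membership.Propositional.Properties using (∈-allFin)
  open import Data.List.Relation.Unary.Unique.Propositional using (Unique)
  open import Data.List.Relation.Unary.Unique.Propositional.Properties using (allFin⁺)
  open import Data.Vec as V using (lookup; toList; tabulate; _++_)
  open import Data.Vec.Properties using (lookup-map; lookup∘tabulate; lookup-++ˡ; lookup-++ʳ; toList-++)
  open import Relation.Binary.PropositionalEquality hiding (J)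
  open DistinctVec
  open Enumeration
  open Hyperoctahedral hiding (Signed)
  open SplitSubgroup k m
  open IncreasingVec {N}

  -- the coset representative a ↦ I_a, k + b ↦ J_b (all signs positive)
  rep : Vec (Fin N) k → Vec (Fin N) m → Signed
  rep I J = V.map (false ,_) (I ++ J)

  σ-rep : ∀ I J i → σ (rep I J) i ≡ lookup (I ++ J) i
  σ-rep I J i = cong proj₂ (lookup-map i (false ,_) (I ++ J))

  σ-rep-↑ˡ : ∀ I J a → σ (rep I J) (a ↑ˡ m) ≡ lookup I a
  σ-rep-↑ˡ I J a = trans (σ-rep I J (a ↑ˡ m)) (lookup-++ˡ I J a)

  σ-rep-↑ʳ : ∀ I J b → σ (rep I J) (k ↑ʳ b) ≡ lookup J b
  σ-rep-↑ʳ I J b = trans (σ-rep I J (k ↑ʳ b)) (lookup-++ʳ I J b)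

  disjointᵇ⇒Distinct : ∀ (I : Vec (Fin N) k) (J : Vec (Fin N) m) → T (disjointᵇ I J) → Distinct (I ++ J)
  disjointᵇ⇒Distinct I J t = distinctᵇ⇒Distinct (I ++ J) (subst (T ∘ distinctᵇ) (sym (toList-++ I J)) t)

  Distinct⇒disjointᵇ : ∀ (I : Vec (Fin N) k) (J : Vec (Fin N) m) → Distinct (I ++ J) → T (disjointᵇ I J)
  Distinct⇒disjointᵇ I J d = subst (T ∘ distinctᵇ) (toList-++ I J) (Distinct⇒distinctᵇ (I ++ J) d)

  IsHyp-rep : ∀ I J → Distinct (I ++ J) → IsHyp (rep I J)
  IsHyp-rep I J d = isHyp λ {i} {j} eq → d (trans (sym (σ-rep I J i)) (trans eq (σ-rep I J j)))

  σ-inv-rep : ∀ I J g i → σ (inv (rep I J) ∘ᵦ g) i ≡ preimage (σ (rep I J)) (σ g i)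
  σ-inv-rep I J g i = trans (σ-∘ᵦ (inv (rep I J)) g i) (cong proj₂ (lookup∘tabulate _ (σ g i)))

  module Position (I : Vec (Fin N) k) (J : Vec (Fin N) m) (d : Distinct (I ++ J)) where

    private
      rep∈B : IsHyp (rep I J)
      rep∈B = IsHyp-rep I J d

    position : Fin N → Fin N
    position = preimage (σ (rep I J))

    σ-rep-position : ∀ x → σ (rep I J) (position x) ≡ x
    σ-rep-position = preimage-inverseʳ (σ (rep I J)) (σ-injective rep∈B)

    isLeft-position⇒∈I : ∀ x → isLeft (position x) ≡ true → x ∈ᵥ I
    isLeft-position⇒∈I x = go (blockView (position x)) (σ-rep-position x)
      where
      go : ∀ {p} → BlockView p → σ (rep I J) p ≡ x → isLeft p ≡ true → x ∈ᵥ I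
      go (left a)  rep-a≡x _       = a , trans (sym (σ-rep-↑ˡ I J a)) rep-a≡x
      go (right b) _       b-left = ⊥-elim (true≢false (trans (sym b-left) (isLeft-↑ʳ b)))

    isRight-position⇒∈J : ∀ x → isLeft (position x) ≡ false → x ∈ᵥ J
    isRight-position⇒∈J x = go (blockView (position x)) (σ-rep-position x)
      where
      go : ∀ {p} → BlockView p → σ (rep I J) p ≡ x → isLeft p ≡ false → x ∈ᵥ J
      go (right b) rep-b≡x _       = b , trans (sym (σ-rep-↑ʳ I J b)) rep-b≡x
      go (left a)  _       a-right = ⊥-elim (true≢false (trans (sym (isLeft-↑ˡ a)) a-right))

    ∈I⇒isLeft-position : ∀ x → x ∈ᵥ I → isLeft (position x) ≡ true
    ∈I⇒isLeft-position x (a , Ia≡x) =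
      trans (cong isLeft (σ-injective rep∈B (trans (σ-rep-position x) (trans (sym Ia≡x) (sym (σ-rep-↑ˡ I J a))))))
            (isLeft-↑ˡ a)

    ∈J⇒isRight-position : ∀ x → x ∈ᵥ J → isLeft (position x) ≡ false
    ∈J⇒isRight-position x (b , Jb≡x) =
      trans (cong isLeft (σ-injective rep∈B (trans (σ-rep-position x) (trans (sym Jb≡x) (sym (σ-rep-↑ʳ I J b))))))
            (isLeft-↑ʳ b)

  -- g lies in the coset rep I J · H exactly for I, J the sorted images of the two blocks under |g|
  imageˡ : Signed → Vec (Fin N) k
  imageˡ g = tabulate λ a → σ g (a ↑ˡ m)

  imageʳ : Signed → Vec (Fin N) m
  imageʳ g = tabulate λ b → σ g (k ↑ʳ b)

  cosetˡ : Signed → Vec (Fin N) k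
  cosetˡ = sort ∘ imageˡ

  cosetʳ : Signed → Vec (Fin N) m
  cosetʳ = sort ∘ imageʳ

  module _ {g : Signed} (g∈B : IsHyp g) where

    private
      imageˡ-distinct : Distinct (imageˡ g)
      imageˡ-distinct {a} {a′} eq = ↑ˡ-injective m a a′
        (σ-injective g∈B (trans (sym (lookup∘tabulate _ a)) (trans eq (lookup∘tabulate _ a′))))

      imageʳ-distinct : Distinct (imageʳ g)
      imageʳ-distinct {b} {b′} eq = ↑ʳ-injective k b b′
        (σ-injective g∈B (trans (sym (lookup∘tabulate _ b)) (trans eq (lookup∘tabulate _ b′))))

    ∈cosetˡ⁻ : ∀ {z} → z ∈ᵥ cosetˡ g → ∃ λ a → σ g (a ↑ˡ m) ≡ z
    ∈cosetˡ⁻ z∈ = let (a , ga≡z) = ∈-sort⁻ (imageˡ g) z∈ in a , trans (sym (lookup∘tabulate _ a)) ga≡z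

    ∈cosetʳ⁻ : ∀ {z} → z ∈ᵥ cosetʳ g → ∃ λ b → σ g (k ↑ʳ b) ≡ z
    ∈cosetʳ⁻ z∈ = let (b , gb≡z) = ∈-sort⁻ (imageʳ g) z∈ in b , trans (sym (lookup∘tabulate _ b)) gb≡z

    ∈cosetˡ⁺ : ∀ a → σ g (a ↑ˡ m) ∈ᵥ cosetˡ g
    ∈cosetˡ⁺ a = ∈-sort⁺ (imageˡ g) (a , lookup∘tabulate _ a)

    ∈cosetʳ⁺ : ∀ b → σ g (k ↑ʳ b) ∈ᵥ cosetʳ g
    ∈cosetʳ⁺ b = ∈-sort⁺ (imageʳ g) (b , lookup∘tabulate _ b)

    cosetˡ-increasing : Increasing (cosetˡ g)
    cosetˡ-increasing = sort-increasing (imageˡ g) imageˡ-distinct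

    cosetʳ-increasing : Increasing (cosetʳ g)
    cosetʳ-increasing = sort-increasing (imageʳ g) imageʳ-distinct

    coset-distinct : Distinct (cosetˡ g ++ cosetʳ g)
    coset-distinct {p} {q} = go (blockView p) (blockView q)
      where
      I = cosetˡ g
      J = cosetʳ g
      across : ∀ a b → lookup I a ≢ lookup J b
      across a b Ia≡Jb with ∈cosetˡ⁻ (a , refl) | ∈cosetʳ⁻ (b , refl)
      ... | (a′ , ga′≡) | (b′ , gb′≡) = true≢false (trans (sym (isLeft-↑ˡ a′))
        (trans (cong isLeft (σ-injective g∈B (trans ga′≡ (trans Ia≡Jb (sym gb′≡))))) (isLeft-↑ʳ b′)))
      go : ∀ {p q} → BlockView p → BlockView q → lookup (I ++ J) p ≡ lookup (I ++ J) q → p ≡ q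
      go (left a) (left a′) eq = cong (_↑ˡ m) (Increasing⇒Distinct I cosetˡ-increasing
        (trans (sym (lookup-++ˡ I J a)) (trans eq (lookup-++ˡ I J a′))))
      go (right b) (right b′) eq = cong (k ↑ʳ_) (Increasing⇒Distinct J cosetʳ-increasing
        (trans (sym (lookup-++ʳ I J b)) (trans eq (lookup-++ʳ I J b′))))
      go (left a) (right b) eq = ⊥-elim (across a b (trans (sym (lookup-++ˡ I J a)) (trans eq (lookup-++ʳ I J b))))
      go (right b) (left a) eq = ⊥-elim (across a b (trans (sym (lookup-++ˡ I J a)) (trans (sym eq) (lookup-++ʳ I J b))))

    InH-coset : InH (inv (rep (cosetˡ g) (cosetʳ g)) ∘ᵦ g)
    InH-coset = inH λ i → trans (cong isLeft (σ-inv-rep (cosetˡ g) (cosetʳ g) g i)) (go (blockView i))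
      where
      open Position (cosetˡ g) (cosetʳ g) coset-distinct
      go : ∀ {i} → BlockView i → isLeft (position (σ g i)) ≡ isLeft i
      go (left a)  = trans (∈I⇒isLeft-position _ (∈cosetˡ⁺ a)) (sym (isLeft-↑ˡ a))
      go (right b) = trans (∈J⇒isRight-position _ (∈cosetʳ⁺ b)) (sym (isLeft-↑ʳ b))

    coset-unique : ∀ {I J} → Increasing I → Increasing J → (d : Distinct (I ++ J)) →
                   InH (inv (rep I J) ∘ᵦ g) → I ≡ cosetˡ g × J ≡ cosetʳ g
    coset-unique {I} {J} I↑ J↑ d g∈repH =
        Increasing-unique I (cosetˡ g) I↑ cosetˡ-increasing I⊆ I⊇
      , Increasing-unique J (cosetʳ g) J↑ cosetʳ-increasing J⊆ J⊇
      where
      open Position I J d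
      block-preserved : ∀ i → isLeft (position (σ g i)) ≡ isLeft i
      block-preserved i = trans (sym (cong isLeft (σ-inv-rep I J g i))) (preserves-blocks g∈repH i)
      I⊆ : ∀ z → z ∈ᵥ I → z ∈ᵥ cosetˡ g
      I⊆ z z∈I with injective⇒surjective (σ g) (σ-injective g∈B) z
      ... | (c , gc≡z) = go (blockView c) gc≡z
        (trans (sym (block-preserved c)) (trans (cong (isLeft ∘ position) gc≡z) (∈I⇒isLeft-position z z∈I)))
        where
        go : ∀ {c} → BlockView c → σ g c ≡ z → isLeft c ≡ true → z ∈ᵥ cosetˡ g
        go (left a)  ga≡z _      = subst (_∈ᵥ cosetˡ g) ga≡z (∈cosetˡ⁺ a)
        go (right b) _    b-left = ⊥-elim (true≢false (trans (sym b-left) (isLeft-↑ʳ b)))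
      I⊇ : ∀ z → z ∈ᵥ cosetˡ g → z ∈ᵥ I
      I⊇ z z∈ with ∈cosetˡ⁻ z∈
      ... | (a , ga≡z) = isLeft-position⇒∈I z
        (trans (cong (isLeft ∘ position) (sym ga≡z)) (trans (block-preserved (a ↑ˡ m)) (isLeft-↑ˡ a)))
      J⊆ : ∀ z → z ∈ᵥ J → z ∈ᵥ cosetʳ g
      J⊆ z z∈J with injective⇒surjective (σ g) (σ-injective g∈B) z
      ... | (c , gc≡z) = go (blockView c) gc≡z
        (trans (sym (block-preserved c)) (trans (cong (isLeft ∘ position) gc≡z) (∈J⇒isRight-position z z∈J)))
        where
        go : ∀ {c} → BlockView c → σ g c ≡ z → isLeft c ≡ false → z ∈ᵥ cosetʳ g
        go (right b) gb≡z _       = subst (_∈ᵥ cosetʳ g) gb≡z (∈cosetʳ⁺ b)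
        go (left a)  _    a-right = ⊥-elim (true≢false (trans (sym (isLeft-↑ˡ a)) a-right))
      J⊇ : ∀ z → z ∈ᵥ cosetʳ g → z ∈ᵥ J
      J⊇ z z∈ with ∈cosetʳ⁻ z∈
      ... | (b , gb≡z) = isRight-position⇒∈J z
        (trans (cong (isLeft ∘ position) (sym gb≡z)) (trans (block-preserved (k ↑ʳ b)) (isLeft-↑ʳ b)))

  cosetˡ∈subsetsInc : ∀ {g} → IsHyp g → cosetˡ g ∈ subsetsInc N k
  cosetˡ∈subsetsInc g∈B = ∈-filterᵇ⁺ _ (∈-allVecs ∈-allFin _) (Increasing⇒increasingᵇ _ (cosetˡ-increasing g∈B))

  cosetʳ∈subsetsInc : ∀ {g} → IsHyp g → cosetʳ g ∈ subsetsInc N m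
  cosetʳ∈subsetsInc g∈B = ∈-filterᵇ⁺ _ (∈-allVecs ∈-allFin _) (Increasing⇒increasingᵇ _ (cosetʳ-increasing g∈B))

  subsetsInc-unique : ∀ l → Unique (subsetsInc N l)
  subsetsInc-unique l = filterᵇ-unique _ (allVecs-unique (allFin⁺ N) l)

  ∈subsetsInc⇒Increasing : ∀ {l} {I : Vec (Fin N) l} → I ∈ subsetsInc N l → Increasing I
  ∈subsetsInc⇒Increasing {l} {I} I∈ = increasingᵇ⇒Increasing I (proj₂ (∈-filterᵇ⁻ (increasingᵇ ∘ toList) {xs = allVecs (allFin N) l} I∈))

module ExactDivision where

  open import Data.Nat using (zero; suc; NonZero)
  open import Data.Nat.Properties using (*-comm)
  open import Data.Nat.DivMod using (m*n/n≡m; m*n%n≡0)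
  open import Data.Integer as ℤ using (+_; -[1+_])
  import Data.Integer.Properties as ℤ
  open import Data.Integer.DivMod using (_/ℕ_)
  open import Relation.Binary.PropositionalEquality

  private
    -[1+]/ℕ : ∀ x d → suc x ℕ.% suc d ≡ 0 → -[1+ x ] /ℕ suc d ≡ ℤ.- (+ (suc x ℕ./ suc d))
    -[1+]/ℕ x d eq with suc x ℕ.% suc d
    -[1+]/ℕ x d refl | zero = refl

  *-/ℕ-cancel : ∀ d .{{_ : NonZero d}} c → (+ d ℤ.* c) /ℕ d ≡ c
  *-/ℕ-cancel (suc d) (+ n) =
    trans (cong (_/ℕ suc d) (sym (ℤ.pos-* (suc d) n)))
          (cong +_ (trans (cong (ℕ._/ suc d) (*-comm (suc d) n)) (m*n/n≡m n (suc d))))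
  *-/ℕ-cancel (suc d) -[1+ n ] =
    trans (-[1+]/ℕ (n ℕ.+ d ℕ.* suc n) d (trans (cong (ℕ._% suc d) d*n≡n*d) (m*n%n≡0 (suc n) (suc d))))
          (cong (λ z → ℤ.- (+ z)) (trans (cong (ℕ._/ suc d) d*n≡n*d) (m*n/n≡m (suc n) (suc d))))
    where
    d*n≡n*d : suc (n ℕ.+ d ℕ.* suc n) ≡ suc n ℕ.* suc d
    d*n≡n*d = *-comm (suc d) (suc n)

module InducedCharacter (k m : ℕ) (ζ : Vec (Fin k) k → ℤ) (ξ : Vec (Fin m) m → ℤ)
                        (ζ-trace : IsTrace k ζ) (ξ-trace : IsTrace m ξ) where

  open import Data.Bool using (true; false; T)
  open import Data.Bool.Properties using (T-≡)
  open import Function.Bundles using (Equivalence)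
  open import Data.Empty using (⊥; ⊥-elim)
  open import Data.Nat using (_^_)
  open import Data.Integer as ℤ using (+_)
  import Data.Integer.Properties as ℤ
  open import Data.Integer.DivMod using (_/ℕ_)
  open import Data.Product using (_×_; _,_)
  open import Data.Product.Properties using () renaming (≡-dec to ×-≡-dec)
  open import Data.List using (List; cartesianProduct)
  open import Data.List.Membership.Propositional using (_∈_)
  open import Data.List.Membership.Propositional.Properties using (∈-cartesianProduct⁺)
  open import Data.List.Relation.Unary.Unique.Propositional.Properties using (cartesianProduct⁺)
  open import Data.Vec using (_++_)
  open import Data.Vec.Properties using () renaming (≡-dec to Vec-≡-dec)
  open import Data.Fin.Properties using () renaming (_≟_ to _≟ᶠ_)
  open import Relation.Binary.PropositionalEquality hiding (J)
  open import Relation.Nullary using (¬_; Dec; yes; no; does)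
  open import Relation.Binary.Definitions using (DecidableEquality)
  open DistinctVec
  open Hyperoctahedral hiding (Signed)
  open SplitSubgroup k m
  open Sums ℤ.+-0-commutativeMonoid using (Σ-H)
  open Character ζ ξ ζ-trace ξ-trace
  open Cosets k m
  open IncreasingVec {N} using (Increasing)
  open SignedPermutations using (Σ-const; Σ-Hyp-1)
  open ListSum ℤ.+-0-commutativeMonoid using (Σ; Σ-cong; Σ-cong-∈; Σ-swap; Σ-reindex; Σ-cartesianProduct; module Indicator)
  open RingSums ℤ.+-*-commutativeRing using (Σ-*ˡ; Σ-if)
  open ExactDivision

  subsetsˡ : List (Vec (Fin N) k)
  subsetsˡ = subsetsInc N k
  subsetsʳ : List (Vec (Fin N) m)
  subsetsʳ = subsetsInc N m

  frobenius : Signed → ℤ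
  frobenius w = Σ subsetsˡ (λ I → Σ subsetsʳ (λ J → if disjointᵇ I J then χ (conj (rep I J) w) else + 0))

  Σ-[wg≡gh] : ∀ {w g} → IsHyp w → IsHyp g →
    Σ (Hyp N) (λ h → if does ((w ∘ᵦ g) ≟ᵥ (g ∘ᵦ h)) then χ h else + 0) ≡ χ (conj g w)
  Σ-[wg≡gh] {w} {g} w∈B g∈B = trans (Σ-cong (Hyp N) solve)
    (Σ-δ-∈ χ Hyp-unique (IsHyp⇒∈Hyp (IsHyp-conj g∈B w∈B)))
    where
    open Indicator (_≟ᵥ_ {N})
    solve : ∀ h → (if does ((w ∘ᵦ g) ≟ᵥ (g ∘ᵦ h)) then χ h else + 0) ≡ δ h (conj g w) (χ h)
    solve h with (w ∘ᵦ g) ≟ᵥ (g ∘ᵦ h) | h ≟ᵥ conj g w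
    ... | yes _     | yes _     = refl
    ... | no _      | no _      = refl
    ... | yes wg≡gh | no h≢     = ⊥-elim (h≢ (trans (sym (inv-∘ᵦˡ g∈B h)) (cong (inv g ∘ᵦ_) (sym wg≡gh))))
    ... | no wg≢gh  | yes h≡    = ⊥-elim (wg≢gh (trans (sym (inv-∘ᵦʳ g∈B (w ∘ᵦ g))) (cong (g ∘ᵦ_) (sym h≡))))

  onCoset : Vec (Fin N) k → Vec (Fin N) m → Signed → ℤ → ℤ
  onCoset I J g c = if disjointᵇ I J then (if does (InH? (inv (rep I J) ∘ᵦ g)) then c else + 0) else + 0

  module _ {g : Signed} (g∈B : IsHyp g) (c : ℤ) where

    private
      _≟ᶜ_ : DecidableEquality (Vec (Fin N) k × Vec (Fin N) m)
      _≟ᶜ_ = ×-≡-dec (Vec-≡-dec {n = k} (_≟ᶠ_ {N})) (Vec-≡-dec {n = m} (_≟ᶠ_ {N}))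
    open Indicator _≟ᶜ_

    private
      guarded-on : ∀ {b} {P : Set} (P? : Dec P) → T b → P → (if b then (if does P? then c else + 0) else + 0) ≡ c
      guarded-on {true} (yes _) _ _ = refl
      guarded-on {true} (no ¬p) _ p = ⊥-elim (¬p p)

      guarded-off : ∀ {b} {P : Set} (P? : Dec P) → (T b → P → ⊥) → (if b then (if does P? then c else + 0) else + 0) ≡ + 0
      guarded-off {false} _       _   = refl
      guarded-off {true}  (no _)  _   = refl
      guarded-off {true}  (yes p) off = ⊥-elim (off _ p)

    onCoset-on : onCoset (cosetˡ g) (cosetʳ g) g c ≡ c
    onCoset-on = guarded-on (InH? _) (Distinct⇒disjointᵇ (cosetˡ g) (cosetʳ g) (coset-distinct g∈B)) (InH-coset g∈B)

    onCoset-off : ∀ {I J} → Increasing I → Increasing J → (I , J) ≢ (cosetˡ g , cosetʳ g) → onCoset I J g c ≡ + 0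
    onCoset-off {I} {J} I↑ J↑ off = guarded-off (InH? _) λ disj g∈IJ →
      let (I≡ , J≡) = coset-unique g∈B I↑ J↑ (disjointᵇ⇒Distinct I J disj) g∈IJ
      in off (cong₂ _,_ I≡ J≡)

    onCoset≡δ : ∀ {I J} → Increasing I → Increasing J → onCoset I J g c ≡ δ (I , J) (cosetˡ g , cosetʳ g) c
    onCoset≡δ {I} {J} I↑ J↑ with (I , J) ≟ᶜ (cosetˡ g , cosetʳ g)
    ... | yes refl = onCoset-on
    ... | no off   = onCoset-off I↑ J↑ off

    Σ-onCoset : Σ subsetsˡ (λ I → Σ subsetsʳ (λ J → onCoset I J g c)) ≡ c
    Σ-onCoset = begin
      Σ subsetsˡ (λ I → Σ subsetsʳ (λ J → onCoset I J g c))
        ≡⟨ Σ-cong-∈ subsetsˡ (λ I∈ → Σ-cong-∈ subsetsʳ (λ J∈ →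
             onCoset≡δ (∈subsetsInc⇒Increasing I∈) (∈subsetsInc⇒Increasing J∈))) ⟩
      Σ subsetsˡ (λ I → Σ subsetsʳ (λ J → δ (I , J) (cosetˡ g , cosetʳ g) c))
        ≡⟨ Σ-cartesianProduct subsetsˡ subsetsʳ (λ IJ → δ IJ (cosetˡ g , cosetʳ g) c) ⟨
      Σ (cartesianProduct subsetsˡ subsetsʳ) (λ IJ → δ IJ (cosetˡ g , cosetʳ g) c)
        ≡⟨ Σ-δ-∈ (λ _ → c) (cartesianProduct⁺ (subsetsInc-unique k) (subsetsInc-unique m))
             (∈-cartesianProduct⁺ (cosetˡ∈subsetsInc g∈B) (cosetʳ∈subsetsInc g∈B)) ⟩
      c ∎
      where open ≡-Reasoning

  Σ-H-const : ∀ c → Σ (Hyp N) (λ h → if does (InH? h) then c else + 0) ≡ + orderH k m ℤ.* c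
  Σ-H-const c = begin
    Σ (Hyp N) (λ h → if does (InH? h) then c else + 0)
      ≡⟨ Σ-H (λ h → if does (InH? h) then c else + 0) off-H ⟩
    Σ (Hyp k) (λ h₁ → Σ (Hyp m) (λ h₂ → if does (InH? (h₁ ⊕ h₂)) then c else + 0))
      ≡⟨ Σ-cong (Hyp k) (λ h₁ → Σ-cong (Hyp m) (λ h₂ → on-H h₁ h₂)) ⟩
    Σ (Hyp k) (λ _ → Σ (Hyp m) (λ _ → c))
      ≡⟨ Σ-cong (Hyp k) (λ _ → trans (Σ-const (Hyp m) c) (cong (ℤ._* c) (Σ-Hyp-1 m))) ⟩
    Σ (Hyp k) (λ _ → |Bₘ| ℤ.* c)
      ≡⟨ trans (Σ-const (Hyp k) (|Bₘ| ℤ.* c)) (cong (ℤ._* (|Bₘ| ℤ.* c)) (Σ-Hyp-1 k)) ⟩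
    |Bₖ| ℤ.* (|Bₘ| ℤ.* c)
      ≡⟨ ℤ.*-assoc |Bₖ| |Bₘ| c ⟨
    |Bₖ| ℤ.* |Bₘ| ℤ.* c
      ≡⟨ cong (ℤ._* c) (ℤ.pos-* (2 ^ k ℕ.* k !) (2 ^ m ℕ.* m !)) ⟨
    + orderH k m ℤ.* c ∎
    where
    open ≡-Reasoning
    |Bₖ| : ℤ
    |Bₖ| = + (2 ^ k ℕ.* k !)
    |Bₘ| : ℤ
    |Bₘ| = + (2 ^ m ℕ.* m !)
    off-H : ∀ {h} → h ∈ Hyp N → ¬ InH h → (if does (InH? h) then c else + 0) ≡ + 0
    off-H {h} _ h∉H with InH? h
    ... | yes h∈H = ⊥-elim (h∉H h∈H)
    ... | no _    = refl
    on-H : ∀ h₁ h₂ → (if does (InH? (h₁ ⊕ h₂)) then c else + 0) ≡ c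
    on-H h₁ h₂ with InH? (h₁ ⊕ h₂)
    ... | yes _   = refl
    ... | no h∉H  = ⊥-elim (h∉H (InH-⊕ h₁ h₂))

  -- summing over g ∈ rep I J · H, that is g = rep I J ∘ h with h ∈ H, the conjugates of w all have the same χ
  Σ-coset : ∀ {w} → IsHyp w → ∀ I J → Distinct (I ++ J) →
    Σ (Hyp N) (λ g → if does (InH? (inv (rep I J) ∘ᵦ g)) then χ (conj g w) else + 0) ≡ + orderH k m ℤ.* χ (conj (rep I J) w)
  Σ-coset {w} w∈B I J d = begin
    Σ (Hyp N) F
      ≡⟨ Σ-reindex _≟ᵥ_ _≟ᵥ_ (R ∘ᵦ_) (inv R ∘ᵦ_) F Hyp-unique Hyp-unique
           (λ h∈ → IsHyp⇒∈Hyp (IsHyp-∘ᵦ R∈B (∈Hyp⇒IsHyp h∈)))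
           (λ g∈ → IsHyp⇒∈Hyp (IsHyp-∘ᵦ (IsHyp-inv R∈B) (∈Hyp⇒IsHyp g∈)))
           (λ {h} _ → inv-∘ᵦˡ R∈B h) (λ {g} _ → inv-∘ᵦʳ R∈B g) ⟨
    Σ (Hyp N) (λ h → F (R ∘ᵦ h))
      ≡⟨ Σ-cong-∈ (Hyp N) F[R∘h] ⟩
    Σ (Hyp N) (λ h → if does (InH? h) then χ (conj R w) else + 0)
      ≡⟨ Σ-H-const (χ (conj R w)) ⟩
    + orderH k m ℤ.* χ (conj R w) ∎
    where
    open ≡-Reasoning
    R : Signed
    R = rep I J
    R∈B : IsHyp R
    R∈B = IsHyp-rep I J d
    F : Signed → ℤ
    F g = if does (InH? (inv R ∘ᵦ g)) then χ (conj g w) else + 0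
    F[R∘h] : ∀ {h} → h ∈ Hyp N → F (R ∘ᵦ h) ≡ (if does (InH? h) then χ (conj R w) else + 0)
    F[R∘h] {h} h∈ = trans (cong (λ x → if does (InH? x) then χ (conj (R ∘ᵦ h) w) else + 0) (inv-∘ᵦˡ R∈B h)) χ-const
      where
      h∈B : IsHyp h
      h∈B = ∈Hyp⇒IsHyp h∈
      χ-const : (if does (InH? h) then χ (conj (R ∘ᵦ h) w) else + 0) ≡ (if does (InH? h) then χ (conj R w) else + 0)
      χ-const with InH? h
      ... | no _    = refl
      ... | yes h∈H = begin
        χ (conj (R ∘ᵦ h) w)    ≡⟨ cong χ (conj-∘ᵦ R∈B h∈B w) ⟩
        χ (conj h (conj R w))  ≡⟨ χ-conj h∈B h∈H (IsHyp-conj R∈B w∈B) ⟩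
        χ (conj R w)           ∎

  Σ-induced-numerator : ∀ {w} → IsHyp w →
    Σ (Hyp N) (λ g → Σ (Hyp N) (λ h → if does ((w ∘ᵦ g) ≟ᵥ (g ∘ᵦ h)) then χ h else + 0)) ≡ + orderH k m ℤ.* frobenius w
  Σ-induced-numerator {w} w∈B = begin
    Σ (Hyp N) (λ g → Σ (Hyp N) (λ h → if does ((w ∘ᵦ g) ≟ᵥ (g ∘ᵦ h)) then χ h else + 0))
      ≡⟨ Σ-cong-∈ (Hyp N) (λ g∈ → Σ-[wg≡gh] w∈B (∈Hyp⇒IsHyp g∈)) ⟩
    Σ (Hyp N) (λ g → χ (conj g w))
      ≡⟨ Σ-cong-∈ (Hyp N) (λ g∈ → sym (Σ-onCoset (∈Hyp⇒IsHyp g∈) _)) ⟩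
    Σ (Hyp N) (λ g → Σ subsetsˡ (λ I → Σ subsetsʳ (λ J → onCoset I J g (χ (conj g w)))))
      ≡⟨ Σ-swap (Hyp N) subsetsˡ (λ g I → Σ subsetsʳ (λ J → onCoset I J g (χ (conj g w)))) ⟩
    Σ subsetsˡ (λ I → Σ (Hyp N) (λ g → Σ subsetsʳ (λ J → onCoset I J g (χ (conj g w)))))
      ≡⟨ Σ-cong subsetsˡ (λ I → Σ-swap (Hyp N) subsetsʳ (λ g J → onCoset I J g (χ (conj g w)))) ⟩
    Σ subsetsˡ (λ I → Σ subsetsʳ (λ J → Σ (Hyp N) (λ g → onCoset I J g (χ (conj g w)))))
      ≡⟨ Σ-cong subsetsˡ (λ I → Σ-cong subsetsʳ (λ J → Σ-cosetᵈ I J)) ⟩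
    Σ subsetsˡ (λ I → Σ subsetsʳ (λ J → + orderH k m ℤ.* (if disjointᵇ I J then χ (conj (rep I J) w) else + 0)))
      ≡⟨ Σ-cong subsetsˡ (λ I → Σ-*ˡ subsetsʳ (+ orderH k m) (λ J → if disjointᵇ I J then χ (conj (rep I J) w) else + 0)) ⟩
    Σ subsetsˡ (λ I → + orderH k m ℤ.* Σ subsetsʳ (λ J → if disjointᵇ I J then χ (conj (rep I J) w) else + 0))
      ≡⟨ Σ-*ˡ subsetsˡ (+ orderH k m) (λ I → Σ subsetsʳ (λ J → if disjointᵇ I J then χ (conj (rep I J) w) else + 0)) ⟩
    + orderH k m ℤ.* frobenius w ∎
    where
    open ≡-Reasoning
    Σ-cosetᵈ : ∀ I J → Σ (Hyp N) (λ g → onCoset I J g (χ (conj g w)))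
                      ≡ + orderH k m ℤ.* (if disjointᵇ I J then χ (conj (rep I J) w) else + 0)
    Σ-cosetᵈ I J with disjointᵇ I J in disj
    ... | false = trans (Σ-if false (Hyp N) (λ g → if does (InH? (inv (rep I J) ∘ᵦ g)) then χ (conj g w) else + 0))
                        (sym (ℤ.*-zeroʳ (+ orderH k m)))
    ... | true  = Σ-coset w∈B I J (disjointᵇ⇒Distinct I J (Equivalence.from T-≡ disj))

  inducedθ≡frobenius : ∀ {w} → IsHyp w → inducedθ k m ζ ξ w ≡ frobenius w
  inducedθ≡frobenius {w} w∈B =
    trans (cong (λ z → _/ℕ_ z (orderH k m) {{orderH-nonZero k m}}) (Σ-induced-numerator w∈B))
          (*-/ℕ-cancel (orderH k m) {{orderH-nonZero k m}} (frobenius w))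

module Immanants {c ℓ} (R : CommutativeRing c ℓ) where

  open import Function using (_∘_)
  open import Data.Bool using (Bool; true; false)
  open import Data.Product using (_,_; proj₁)
  open import Data.List using (allFin)
  open import Data.Vec using (lookup)
  import Relation.Binary.PropositionalEquality as P
  open CommutativeRing R hiding (zero)
  open RingDefs R
  open RingSums R
  open Enumeration using (bools)
  open Hyperoctahedral using (σ)
  open SignedPermutations using (lookup-withSigns; φ-withSigns)
  open SignedPermutations.Sums +-commutativeMonoid using (Σ-Hyp-withSigns)
  open import Relation.Binary.Reasoning.Setoid setoid

  Imm-cong : ∀ {n l} (ζ : Vec (Fin l) l → ℤ) {Y Y′ : Fin n → Fin n → Carrier} → (∀ i j → Y i j ≈ Y′ i j) →
             ∀ K → Imm ζ Y K ≈ Imm ζ Y′ K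
  Imm-cong {l = l} ζ Y≈Y′ K = Σ-cong (Sym l) (λ u → *-congˡ (Π-cong (allFin l) (λ a → Y≈Y′ _ _)))

  -- Summing over the signs of h ∈ B_l expands each factor into a weighted sum of two entries.
  Σ-Hyp-Imm : ∀ {n l} (ζ : Vec (Fin l) l → ℤ) (Q : Fin n → SFin n → Carrier) (wt : Bool → Carrier) (K : Vec (Fin n) l) →
    ΣR (Hyp l) (λ h → ι (ζ (φ h)) * ΠR (allFin l) (λ a →
        wt (proj₁ (lookup h a)) * Q (lookup K a) (proj₁ (lookup h a) , lookup K (σ h a))))
    ≈ Imm ζ (λ i j → wt true * Q i (true , j) + wt false * Q i (false , j)) K
  Σ-Hyp-Imm {l = l} ζ Q wt K = begin
    ΣR (Hyp l) F
      ≈⟨ Σ-Hyp-withSigns F ⟩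
    ΣR (allVecs bools l) (λ ε → ΣR (Sym l) (λ u → F (withSigns ε u)))
      ≈⟨ Σ-cong (allVecs bools l) (λ ε → Σ-cong (Sym l) (λ u → F-withSigns ε u)) ⟩
    ΣR (allVecs bools l) (λ ε → ΣR (Sym l) (λ u → ι (ζ u) * ΠR (allFin l) (λ a → W u a (lookup ε a))))
      ≈⟨ Σ-swap (allVecs bools l) (Sym l) (λ ε u → ι (ζ u) * ΠR (allFin l) (λ a → W u a (lookup ε a))) ⟩
    ΣR (Sym l) (λ u → ΣR (allVecs bools l) (λ ε → ι (ζ u) * ΠR (allFin l) (λ a → W u a (lookup ε a))))
      ≈⟨ Σ-cong (Sym l) (λ u → Σ-*ˡ (allVecs bools l) (ι (ζ u)) (λ ε → ΠR (allFin l) (λ a → W u a (lookup ε a)))) ⟩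
    ΣR (Sym l) (λ u → ι (ζ u) * ΣR (allVecs bools l) (λ ε → ΠR (allFin l) (λ a → W u a (lookup ε a))))
      ≈⟨ Σ-cong (Sym l) (λ u → *-congˡ (Σ-allVecs-Π l (W u))) ⟩
    Imm ζ (λ i j → wt true * Q i (true , j) + wt false * Q i (false , j)) K ∎
    where
    open SignedPermutations using (withSigns)
    F : Vec (SFin l) l → Carrier
    F h = ι (ζ (φ h)) * ΠR (allFin l) (λ a → wt (proj₁ (lookup h a)) * Q (lookup K a) (proj₁ (lookup h a) , lookup K (σ h a)))
    W : Vec (Fin l) l → Fin l → Bool → Carrier
    W u a s = wt s * Q (lookup K a) (s , lookup K (lookup u a))
    F-withSigns : ∀ ε u → F (withSigns ε u) ≈ ι (ζ u) * ΠR (allFin l) (λ a → W u a (lookup ε a))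
    F-withSigns ε u = *-cong (reflexive (P.cong (ι ∘ ζ) (φ-withSigns ε u)))
      (Π-cong (allFin l) (λ a → reflexive (P.cong (λ (s , j) → wt s * Q (lookup K a) (s , lookup K j)) (lookup-withSigns ε u a))))

  module OnCoset (k m : ℕ) (ζ : Vec (Fin k) k → ℤ) (ξ : Vec (Fin m) m → ℤ)
                 (ζ-trace : IsTrace k ζ) (ξ-trace : IsTrace m ξ) (x : SFin (k ℕ.+ m) → SFin (k ℕ.+ m) → Carrier) where

    open import Data.Bool using (_xor_)
    open import Data.Bool.Properties using (xor-identityʳ)
    open import Data.Fin using (_↑ˡ_; _↑ʳ_)
    open import Data.Integer as ℤ using ()
    open import Data.Vec using (_++_)
    open import Data.Vec.Properties using (lookup-map)
    open import Data.List.Membership.Propositional using (_∈_)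
    open import Algebra.Properties.CommutativeSemigroup *-commutativeSemigroup using (interchange)
    open import Algebra.Properties.Ring ring using (-‿distribˡ-*)
    open IntegerEmbedding R
    open DistinctVec using (Distinct)
    open Signs
    open Hyperoctahedral hiding (Signed; σ)
    open SplitSubgroup k m
    open Sums +-commutativeMonoid using (Σ-H)
    open Character ζ ξ ζ-trace ξ-trace
    open Cosets k m

    pairFactor : Fin N → SFin N → Carrier
    pairFactor i z = x (true , i) (negS z) * x (false , i) z

    monomial : Signed → Carrier
    monomial w = ΠR (allFin N) (λ i → pairFactor i (lookup w i))

    module _ (I : Vec (Fin N) k) (J : Vec (Fin N) m) (d : Distinct (I ++ J)) where

      private
        Rep : Signed
        Rep = rep I J
        Rep∈B : IsHyp Rep
        Rep∈B = IsHyp-rep I J d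
        ν : Fin N → Fin N
        ν = σ Rep

      monomialᴵ : Vec (SFin k) k → Carrier
      monomialᴵ h₁ = ΠR (allFin k) (λ a → pairFactor (lookup I a) (proj₁ (lookup h₁ a) , lookup I (σ h₁ a)))

      monomialᴶ : Vec (SFin m) m → Carrier
      monomialᴶ h₂ = ΠR (allFin m) (λ b → pairFactor (lookup J b) (proj₁ (lookup h₂ b) , lookup J (σ h₂ b)))

      applyB-rep : ∀ s j → applyB Rep (s , j) P.≡ (s , ν j)
      applyB-rep s j = P.cong (_, ν j)
        (P.trans (P.cong (λ (z : SFin N) → s xor proj₁ z) (lookup-map j (λ (i : Fin N) → (false , i)) (I ++ J))) (xor-identityʳ s))

      lookup-unconj-rep : ∀ h p → lookup (unconj Rep h) (ν p) P.≡ (proj₁ (lookup h p) , ν (σ h p))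
      lookup-unconj-rep h p = P.trans (applyB-∘ᵦ Rep (h ∘ᵦ inv Rep) (false , ν p))
        (P.trans (P.cong (applyB Rep) (applyB-∘ᵦ h (inv Rep) (false , ν p)))
        (P.trans (P.cong (λ z → applyB Rep (applyB h z))
                         (P.trans (P.cong (applyB (inv Rep)) (P.sym (applyB-rep false p))) (inv-applyˡ Rep∈B (false , p))))
          (applyB-rep (proj₁ (lookup h p)) (σ h p))))

      -- reindexing the rows by ν = |rep I J| splits the monomial into its I- and J-parts
      monomial-unconj-⊕ : ∀ h₁ h₂ → monomial (unconj Rep (h₁ ⊕ h₂)) ≈ monomialᴵ h₁ * monomialᴶ h₂
      monomial-unconj-⊕ h₁ h₂ = begin
        monomial (unconj Rep h)
          ≈⟨ Π-permute ν (σ-injective Rep∈B) (λ i → pairFactor i (lookup (unconj Rep h) i)) ⟨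
        ΠR (allFin N) (λ p → pairFactor (ν p) (lookup (unconj Rep h) (ν p)))
          ≈⟨ Π-cong (allFin N) (λ p → reflexive (P.cong (pairFactor (ν p)) (lookup-unconj-rep h p))) ⟩
        ΠR (allFin N) (λ p → pairFactor (ν p) (proj₁ (lookup h p) , ν (σ h p)))
          ≈⟨ Π-allFin-+ k m _ ⟩
        ΠR (allFin k) (λ a → pairFactor (ν (a ↑ˡ m)) (proj₁ (lookup h (a ↑ˡ m)) , ν (σ h (a ↑ˡ m))))
          * ΠR (allFin m) (λ b → pairFactor (ν (k ↑ʳ b)) (proj₁ (lookup h (k ↑ʳ b)) , ν (σ h (k ↑ʳ b))))
          ≈⟨ *-cong (Π-cong (allFin k) (λ a → reflexive (on-I a))) (Π-cong (allFin m) (λ b → reflexive (on-J b))) ⟩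
        monomialᴵ h₁ * monomialᴶ h₂ ∎
        where
        h : Signed
        h = h₁ ⊕ h₂
        on-I : ∀ a → pairFactor (ν (a ↑ˡ m)) (proj₁ (lookup h (a ↑ˡ m)) , ν (σ h (a ↑ˡ m)))
                     P.≡ pairFactor (lookup I a) (proj₁ (lookup h₁ a) , lookup I (σ h₁ a))
        on-I a rewrite lookup-⊕-↑ˡ h₁ h₂ a | σ-rep-↑ˡ I J a | σ-rep-↑ˡ I J (σ h₁ a) = P.refl
        on-J : ∀ b → pairFactor (ν (k ↑ʳ b)) (proj₁ (lookup h (k ↑ʳ b)) , ν (σ h (k ↑ʳ b)))
                     P.≡ pairFactor (lookup J b) (proj₁ (lookup h₂ b) , lookup J (σ h₂ b))
        on-J b rewrite lookup-⊕-↑ʳ h₁ h₂ b | σ-rep-↑ʳ I J b | σ-rep-↑ʳ I J (σ h₂ b) = P.refl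

      Σ-Hyp-plus : ΣR (Hyp k) (λ h₁ → ι (ζ (φ h₁)) * monomialᴵ h₁) ≈ Imm ζ (xplus x) I
      Σ-Hyp-plus = begin
        ΣR (Hyp k) (λ h₁ → ι (ζ (φ h₁)) * monomialᴵ h₁)
          ≈⟨ Σ-cong (Hyp k) (λ h₁ → *-congˡ (Π-cong (allFin k) (λ a → sym (*-identityˡ _)))) ⟩
        ΣR (Hyp k) (λ h₁ → ι (ζ (φ h₁)) * ΠR (allFin k) (λ a →
          1# * pairFactor (lookup I a) (proj₁ (lookup h₁ a) , lookup I (σ h₁ a))))
          ≈⟨ Σ-Hyp-Imm ζ pairFactor (λ _ → 1#) I ⟩
        Imm ζ (λ i j → 1# * pairFactor i (true , j) + 1# * pairFactor i (false , j)) I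
          ≈⟨ Imm-cong ζ (λ i j → plus-entry (x (true , i) (false , j)) (x (false , i) (true , j)) (x (true , i) (true , j)) (x (false , i) (false , j))) I ⟩
        Imm ζ (xplus x) I ∎
        where
        plus-entry : ∀ p q r s → 1# * (p * q) + 1# * (r * s) ≈ s * r + q * p
        plus-entry p q r s = trans (+-cong (*-identityˡ _) (*-identityˡ _)) (trans (+-comm _ _) (+-cong (*-comm r s) (*-comm p q)))

      Σ-Hyp-minus : ΣR (Hyp m) (λ h₂ → ι (signℓt h₂ ℤ.* ξ (φ h₂)) * monomialᴶ h₂) ≈ Imm ξ (xminus x) J
      Σ-Hyp-minus = begin
        ΣR (Hyp m) (λ h₂ → ι (signℓt h₂ ℤ.* ξ (φ h₂)) * monomialᴶ h₂)
          ≈⟨ Σ-cong (Hyp m) signs-inside ⟩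
        ΣR (Hyp m) (λ h₂ → ι (ξ (φ h₂)) * ΠR (allFin m) (λ b →
          ι (sign (proj₁ (lookup h₂ b))) * pairFactor (lookup J b) (proj₁ (lookup h₂ b) , lookup J (σ h₂ b))))
          ≈⟨ Σ-Hyp-Imm ξ pairFactor (ι ∘ sign) J ⟩
        Imm ξ (λ i j → ι (sign true) * pairFactor i (true , j) + ι (sign false) * pairFactor i (false , j)) J
          ≈⟨ Imm-cong ξ (λ i j → minus-entry (x (true , i) (false , j)) (x (false , i) (true , j)) (x (true , i) (true , j)) (x (false , i) (false , j))) J ⟩
        Imm ξ (xminus x) J ∎
        where
        signs-inside : ∀ h₂ → ι (signℓt h₂ ℤ.* ξ (φ h₂)) * monomialᴶ h₂
          ≈ ι (ξ (φ h₂)) * ΠR (allFin m) (λ b →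
              ι (sign (proj₁ (lookup h₂ b))) * pairFactor (lookup J b) (proj₁ (lookup h₂ b) , lookup J (σ h₂ b)))
        signs-inside h₂ = begin
          ι (signℓt h₂ ℤ.* ξ (φ h₂)) * monomialᴶ h₂        ≈⟨ *-congʳ (trans (ι-* (signℓt h₂) (ξ (φ h₂))) (*-comm _ _)) ⟩
          (ι (ξ (φ h₂)) * ι (signℓt h₂)) * monomialᴶ h₂    ≈⟨ *-assoc (ι (ξ (φ h₂))) (ι (signℓt h₂)) (monomialᴶ h₂) ⟩
          ι (ξ (φ h₂)) * (ι (signℓt h₂) * monomialᴶ h₂)
            ≈⟨ *-congˡ (*-congʳ (trans (reflexive (P.cong ι (signℓt≡Π h₂))) (ι-Π (allFin m) (λ b → sign (proj₁ (lookup h₂ b)))))) ⟩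
          ι (ξ (φ h₂)) * (ΠR (allFin m) (λ b → ι (sign (proj₁ (lookup h₂ b)))) * monomialᴶ h₂)
            ≈⟨ *-congˡ (sym (Π-* (allFin m) (λ b → ι (sign (proj₁ (lookup h₂ b))))
                                             (λ b → pairFactor (lookup J b) (proj₁ (lookup h₂ b) , lookup J (σ h₂ b))))) ⟩
          ι (ξ (φ h₂)) * ΠR (allFin m) (λ b →
              ι (sign (proj₁ (lookup h₂ b))) * pairFactor (lookup J b) (proj₁ (lookup h₂ b) , lookup J (σ h₂ b))) ∎
        minus-entry : ∀ p q r s → ι (sign true) * (p * q) + ι (sign false) * (r * s) ≈ s * r - q * p
        minus-entry p q r s = begin
          ι (sign true) * (p * q) + ι (sign false) * (r * s)  ≈⟨ +-cong (*-congʳ (ι-neg (ℤ.+ 1))) (*-congʳ ι-1) ⟩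
          - ι (ℤ.+ 1) * (p * q) + 1# * (r * s)                ≈⟨ +-cong (*-congʳ (-‿cong ι-1)) (*-identityˡ _) ⟩
          - 1# * (p * q) + r * s                              ≈⟨ +-congʳ (sym (-‿distribˡ-* 1# (p * q))) ⟩
          - (1# * (p * q)) + r * s                            ≈⟨ +-congʳ (-‿cong (*-identityˡ _)) ⟩
          - (p * q) + r * s                                   ≈⟨ +-comm _ _ ⟩
          r * s - p * q                                       ≈⟨ +-cong (*-comm r s) (-‿cong (*-comm p q)) ⟩
          s * r - q * p                                       ∎

      Σ-conj-monomial : ΣR (Hyp N) (λ w → ι (χ (conj Rep w)) * monomial w) ≈ Imm ζ (xplus x) I * Imm ξ (xminus x) J
      Σ-conj-monomial = begin
        ΣR (Hyp N) (λ w → ι (χ (conj Rep w)) * monomial w)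
          ≈⟨ Σ-reindex _≟ᵥ_ _≟ᵥ_ (unconj Rep) (conj Rep) (λ w → ι (χ (conj Rep w)) * monomial w) Hyp-unique Hyp-unique
               (λ h∈ → IsHyp⇒∈Hyp (IsHyp-unconj Rep∈B (∈Hyp⇒IsHyp h∈)))
               (λ w∈ → IsHyp⇒∈Hyp (IsHyp-conj Rep∈B (∈Hyp⇒IsHyp w∈)))
               (λ {h} _ → conj-unconj Rep∈B h) (λ {w} _ → unconj-conj Rep∈B w) ⟨
        ΣR (Hyp N) (λ h → ι (χ (conj Rep (unconj Rep h))) * monomial (unconj Rep h))
          ≈⟨ Σ-cong (Hyp N) (λ h → *-congʳ (reflexive (P.cong (ι ∘ χ) (conj-unconj Rep∈B h)))) ⟩
        ΣR (Hyp N) (λ h → ι (χ h) * monomial (unconj Rep h))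
          ≈⟨ Σ-H (λ h → ι (χ h) * monomial (unconj Rep h))
                 (λ {h} _ h∉H → trans (*-congʳ (reflexive (P.cong ι (χ-¬InH h h∉H)))) (zeroˡ _)) ⟩
        ΣR (Hyp k) (λ h₁ → ΣR (Hyp m) (λ h₂ → ι (χ (h₁ ⊕ h₂)) * monomial (unconj Rep (h₁ ⊕ h₂))))
          ≈⟨ Σ-cong (Hyp k) (λ h₁ → Σ-cong (Hyp m) (λ h₂ → factorise h₁ h₂)) ⟩
        ΣR (Hyp k) (λ h₁ → ΣR (Hyp m) (λ h₂ → termᴵ h₁ * termᴶ h₂))
          ≈⟨ Σ-*-Σ (Hyp k) (Hyp m) termᴵ termᴶ ⟩
        ΣR (Hyp k) termᴵ * ΣR (Hyp m) termᴶ
          ≈⟨ *-cong Σ-Hyp-plus Σ-Hyp-minus ⟩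
        Imm ζ (xplus x) I * Imm ξ (xminus x) J ∎
        where
        termᴵ : Vec (SFin k) k → Carrier
        termᴵ h₁ = ι (ζ (φ h₁)) * monomialᴵ h₁
        termᴶ : Vec (SFin m) m → Carrier
        termᴶ h₂ = ι (signℓt h₂ ℤ.* ξ (φ h₂)) * monomialᴶ h₂
        factorise : ∀ h₁ h₂ → ι (χ (h₁ ⊕ h₂)) * monomial (unconj Rep (h₁ ⊕ h₂)) ≈ termᴵ h₁ * termᴶ h₂
        factorise h₁ h₂ = begin
          ι (χ (h₁ ⊕ h₂)) * monomial (unconj Rep (h₁ ⊕ h₂))
            ≈⟨ *-cong (reflexive (P.cong ι (χ-⊕ h₁ h₂))) (monomial-unconj-⊕ h₁ h₂) ⟩
          ι (ζ (φ h₁) ℤ.* (signℓt h₂ ℤ.* ξ (φ h₂))) * (monomialᴵ h₁ * monomialᴶ h₂)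
            ≈⟨ *-congʳ (ι-* (ζ (φ h₁)) (signℓt h₂ ℤ.* ξ (φ h₂))) ⟩
          (ι (ζ (φ h₁)) * ι (signℓt h₂ ℤ.* ξ (φ h₂))) * (monomialᴵ h₁ * monomialᴶ h₂)
            ≈⟨ interchange _ _ _ _ ⟩
          termᴵ h₁ * termᴶ h₂ ∎

lemma6p3 : ∀ {c ℓ : Level} (R : CommutativeRing c ℓ) (k m : ℕ)
    (ζ : Vec (Fin k) k → ℤ) (ξ : Vec (Fin m) m → ℤ)
    → IsTrace k ζ → IsTrace m ξ
    → (x : SFin (k ℕ.+ m) → SFin (k ℕ.+ m) → CommutativeRing.Carrier R)
    → let open CommutativeRing R
          open RingDefs R
      in ImmB (inducedθ k m ζ ξ) x
         ≈ ΣR (subsetsInc (k ℕ.+ m) k) (λ I → ΣR (subsetsInc (k ℕ.+ m) m) (λ J →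
             if disjointᵇ I J
             then Imm ζ (xplus x) I * Imm ξ (xminus x) J
             else 0#))
lemma6p3 R k m ζ ξ ζ-trace ξ-trace x = begin
  ΣR (Hyp N) (λ w → ι (inducedθ k m ζ ξ w) * monomial w)
    ≈⟨ Σ-cong-∈ (Hyp N) (λ w∈ → *-congʳ (reflexive (cong ι (inducedθ≡frobenius (∈Hyp⇒IsHyp w∈))))) ⟩
  ΣR (Hyp N) (λ w → ι (frobenius w) * monomial w)
    ≈⟨ Σ-cong (Hyp N) expand ⟩
  ΣR (Hyp N) (λ w → ΣR subsetsˡ (λ I → ΣR subsetsʳ (λ J → term I J w)))
    ≈⟨ trans (Σ-swap (Hyp N) subsetsˡ _) (Σ-cong subsetsˡ (λ I → Σ-swap (Hyp N) subsetsʳ (λ w J → term I J w))) ⟩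
  ΣR subsetsˡ (λ I → ΣR subsetsʳ (λ J → ΣR (Hyp N) (term I J)))
    ≈⟨ Σ-cong subsetsˡ (λ I → Σ-cong subsetsʳ (λ J → per-coset I J)) ⟩
  ΣR subsetsˡ (λ I → ΣR subsetsʳ (λ J → if disjointᵇ I J then Imm ζ (xplus x) I * Imm ξ (xminus x) J else 0#)) ∎
  where
  open CommutativeRing R
  open RingDefs R
  open RingSums R
  import Data.Integer as ℤ
  open import Relation.Binary.PropositionalEquality using (cong)
  open import Relation.Binary.Reasoning.Setoid setoid
  open Hyperoctahedral using (∈Hyp⇒IsHyp; conj)
  open SplitSubgroup k m using (N)
  open SplitSubgroup.Character k m ζ ξ ζ-trace ξ-trace using (χ)
  open Cosets k m using (rep; disjointᵇ⇒Distinct)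
  open InducedCharacter k m ζ ξ ζ-trace ξ-trace using (frobenius; inducedθ≡frobenius; subsetsˡ; subsetsʳ)
  open Immanants.OnCoset R k m ζ ξ ζ-trace ξ-trace x using (monomial; Σ-conj-monomial)

  term : Vec (Fin N) k → Vec (Fin N) m → Vec (SFin N) N → Carrier
  term I J w = if disjointᵇ I J then ι (χ (conj (rep I J) w)) * monomial w else 0#

  expand : ∀ w → ι (frobenius w) * monomial w ≈ ΣR subsetsˡ (λ I → ΣR subsetsʳ (λ J → term I J w))
  expand w = trans (ι-Σ-*ʳ subsetsˡ (λ I → Σℤ subsetsʳ (χᵂ I)) (monomial w)) (Σ-cong subsetsˡ (λ I →
    trans (ι-Σ-*ʳ subsetsʳ (χᵂ I) (monomial w)) (Σ-cong subsetsʳ (λ J → ι-if-*ʳ (disjointᵇ I J) _ (monomial w)))))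
    where
    χᵂ : Vec (Fin N) k → Vec (Fin N) m → ℤ
    χᵂ I J = if disjointᵇ I J then χ (conj (rep I J) w) else ℤ.+ 0

  per-coset : ∀ I J → ΣR (Hyp N) (term I J) ≈ (if disjointᵇ I J then Imm ζ (xplus x) I * Imm ξ (xminus x) J else 0#)
  per-coset I J = trans (Σ-if (disjointᵇ I J) (Hyp N) (λ w → ι (χ (conj (rep I J) w)) * monomial w))
    (if-congᵗ (disjointᵇ I J) (λ disj → Σ-conj-monomial I J (disjointᵇ⇒Distinct I J disj)))
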